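{- Suppose there exist an $\mathrm{SCCD}(v,k,b)$ on point set $X$ with excess $e$ and an $\mathrm{SCCD}(v',k,b')$ on point set $X'$ with excess $e'$, each having an outer expansion set that contains both its $U_0$ and its $U_b$ (resp. $U'_0$ and $U'_{b'}$), where $|X\cap X'|=k-1$. Then, with $v^*=v+v'-k+1$, $b^*=b+b'+\frac{(v'-k+1)(v-k+1)}{k-1}$ and $X^*=X\cup X'$, there exists an $\mathrm{SCCD}(v^*,k,b^*)$ on $X^*$ with excess $e^*=e+e'$ and a disjoint-capable outer expansion set.
   Context: An $\mathrm{SCCD}(v,k,b)$ (linear single change covering design) is a $v$-set $X$ with an ordered list $(B_1,\dots,B_b)$ of $k$-subsets of $X$ with $|B_i\cap B_{i+1}|=k-1$ for $1\le i<b$, such that every pair of elements of $X$ is contained in some block. Its excess is $e=(k-1)b+\binom{k-1}{2}-\binom{v}{2}$. The unchanged subsets are $U_i=B_i\cap B_{i+1}$ for $1\le i\le b-1$; in addition $U_0$ may be any $(k-1)$-subset of $B_1$ and $U_b$ any $(k-1)$-subset of $B_b$. An expansion set is a collection of $\frac{v}{k-1}$ unchanged subsets (distinct indices in $\{0,\dots,b\}$) that are pairwise disjoint with union $X$; it is outer if it contains $U_0$ or $U_b$. An expansion set is disjoint-capable if (1) it contains $U_0$ and $U_b$; (2) $U_0=U_1=U_2=\cdots=U_{k-1}$; and (3) $U_b=\bigcup_{i=1}^{k-1}(B_i\setminus B_{i+1})$. -}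

module Defs where

open import Data.Nat using (ℕ; zero; suc; _+_; _*_; _∸_; _≤_; _<_)
open import Data.Nat.DivMod using (_/_)
open import Data.Nat.Combinatorics using (_C_)
open import Data.Integer using (ℤ; +_) renaming (_+_ to _+ℤ_; _-_ to _-ℤ_)
open import Data.Nat.Properties using (_≟_)
open import Data.Fin using (Fin)
open import Data.Fin.Subset using (Subset; _∈_; _⊆_; _∩_; _∪_; _─_; ⊥; ⋃; ∣_∣)
open import Data.List using (List; map; upTo)
open import Data.List.Relation.Unary.All using (All)
open import Data.List.Relation.Unary.Unique.Propositional using (Unique)
import Data.List.Membership.Propositional as LM
open import Data.Product using (Σ; _×_; ∃)
open import Relation.Binary.PropositionalEquality using (_≡_; _≢_)
open import Relation.Nullary using (yes; no)

-- Linear single change covering design SCCD(v,k,b) on point set X.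
-- The blocks are B 1, …, B b (values of B at other indices are irrelevant).
record SCCD {n : ℕ} (X : Subset n) (v k b : ℕ) : Set where
  field
    B          : ℕ → Subset n
    cardX      : ∣ X ∣ ≡ v
    block⊆X    : ∀ i → 1 ≤ i → i ≤ b → B i ⊆ X
    blockSize  : ∀ i → 1 ≤ i → i ≤ b → ∣ B i ∣ ≡ k
    singleChg  : ∀ i → 1 ≤ i → i < b → ∣ B i ∩ B (suc i) ∣ ≡ k ∸ 1
    covering   : ∀ (x y : Fin n) → x ∈ X → y ∈ X → x ≢ y →
                 Σ ℕ λ i → 1 ≤ i × i ≤ b × x ∈ B i × y ∈ B i

excess : ℕ → ℕ → ℕ → ℤ
excess v k b = (+ ((k ∸ 1) * b) +ℤ + ((k ∸ 1) C 2)) -ℤ + (v C 2)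

unchanged : ∀ {n} → (B : ℕ → Subset n) (b : ℕ) (U0 Ub : Subset n) → ℕ → Subset n
unchanged B b U0 Ub zero = U0
unchanged B b U0 Ub (suc i) with suc i ≟ b
... | yes _ = Ub
... | no  _ = B (suc i) ∩ B (suc (suc i))

-- An expansion set of an SCCD: a choice of U_0 ((k-1)-subset of B_1) and
-- U_b ((k-1)-subset of B_b), together with v/(k-1) distinct indices in
-- {0,…,b} whose unchanged subsets are pairwise disjoint with union X.
-- "v/(k-1) indices" is expressed as (k-1) * #indices = v.
record ExpansionSet {n : ℕ} {X : Subset n} {v k b : ℕ} (D : SCCD X v k b) : Set where
  open SCCD D
  field
    b≥1      : 1 ≤ b
    U0       : Subset n
    Ub       : Subset n
    U0⊆B1    : U0 ⊆ B 1
    ∣U0∣     : ∣ U0 ∣ ≡ k ∸ 1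
    Ub⊆Bb    : Ub ⊆ B b
    ∣Ub∣     : ∣ Ub ∣ ≡ k ∸ 1
    idx      : List ℕ
    idx≤b    : All (_≤ b) idx
    idxUniq  : Unique idx
    idxCount : (k ∸ 1) * Data.List.length idx ≡ v
    disjoint : ∀ i j → i LM.∈ idx → j LM.∈ idx → i ≢ j →
               unchanged B b U0 Ub i ∩ unchanged B b U0 Ub j ≡ ⊥
    cover    : ⋃ (map (unchanged B b U0 Ub) idx) ≡ X

  U : ℕ → Subset n
  U = unchanged B b U0 Ub

ContainsBothEnds : ∀ {n} {X : Subset n} {v k b} {D : SCCD X v k b} → ExpansionSet D → Set
ContainsBothEnds {b = b} E = 0 LM.∈ idx × b LM.∈ idx
  where open ExpansionSet E

Outer : ∀ {n} {X : Subset n} {v k b} {D : SCCD X v k b} → ExpansionSet D → Set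
Outer {b = b} E = (0 LM.∈ idx) Data.Sum.⊎ (b LM.∈ idx)
  where open ExpansionSet E
        import Data.Sum

-- Disjoint-capable: (1) contains U_0 and U_b; (2) U_0 = U_1 = … = U_{k-1};
-- (3) U_b = ⋃_{i=1}^{k-1} (B_i ∖ B_{i+1}).
DisjointCapable : ∀ {n} {X : Subset n} {v k b} {D : SCCD X v k b} → ExpansionSet D → Set
DisjointCapable {k = k} {b = b} {D = D} E =
  (0 LM.∈ idx × b LM.∈ idx)
  × (∀ i → i ≤ k ∸ 1 → U i ≡ U0)
  × (Ub ≡ ⋃ (map (λ j → SCCD.B D (suc j) ─ SCCD.B D (suc (suc j))) (upTo (k ∸ 1))))
  where open ExpansionSet E

-- natural-number division, m div d = ⌊m/d⌋ (0 when d = 0; only used with d ≥ 1)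
_div_ : ℕ → ℕ → ℕ
m div zero = 0
m div suc d = m / suc d

-- The two designs are glued along W = X ∩ X'. Relabelling points of X (resp. X') by
-- transpositions changes nothing essential, so we may assume that the last unchanged set U_b
-- of the first design and the first one U'_0 of the second both equal W; then B_b ∩ B'_1 = W
-- and the list B_1, …, B_b, B'_1, …, B'_b' is again linear. It covers every pair inside X or
-- inside X'. To cover x ∈ X ∖ X' and y ∈ X' ∖ X, for every index j < b of the expansion set
-- the t = v' - (k-1) blocks U_j ∪ {y}, y ∈ X' ∖ X, are inserted between B_j and B_{j+1}: each
-- meets its neighbours in U_j, and x lies in some U_j. This adds t (v/(k-1) - 1) blocks. The
-- parts of both expansion sets (without U'_0 = U_b) stay unchanged subsets of the new list, and
-- inserting the points of U'_b' first makes the new expansion set disjoint-capable. The excess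
-- is then additive by the binomial identity C(x+y,2) = C(x,2) + C(y,2) + xy.

module Submission where

open import Defs
open import Data.Nat using (ℕ; _+_; _*_; _∸_; _≤_)
open import Data.Integer using () renaming (_+_ to _+ℤ_)
open import Data.Fin.Subset using (Subset; _∩_; _∪_; ∣_∣)
open import Data.Product using (Σ; _×_)
open import Relation.Binary.PropositionalEquality using (_≡_)

open import Data.Nat using (zero; suc; _<_; z≤n; s≤s; s≤s⁻¹)
open import Data.Nat.Properties
open import Data.Nat.Combinatorics using (_C_; nC1≡n; nCk+nC[k+1]≡[n+1]C[k+1])
open import Data.Nat.DivMod using (_/_; m*n/n≡m)
open import Data.Nat.Solver using (module +-*-Solver)
import Data.Integer.Properties as ℤ
import Data.Integer.Solver
open import Data.Fin using (Fin; zero; suc)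
import Data.Fin.Properties as Fin
open import Data.Fin.Permutation.Components using (transpose; transpose-inverse)
open import Data.Fin.Subset using (_∈_; _∉_; _⊆_; _─_; ⊥; ⋃; ⁅_⁆; Nonempty; inside; outside)
open import Data.Fin.Subset.Properties
  using (⊆-antisym; _∈?_; ∉⊥; ∣⊥∣≡0; x∈⁅x⁆; x∈⁅y⁆⇒x≡y; ∣⁅x⁆∣≡1; x∈p∩q⁺; x∈p∩q⁻; x∈p∪q⁺; x∈p∪q⁻;
         x∈p∧x∉q⇒x∈p─q; p⊆q⇒∣p∣≤∣q∣; drop-∷-⊆; ∩-comm)
open import Data.Vec using ([]; _∷_; here; there; tabulate; lookup)
open import Data.Vec.Properties using (lookup∘tabulate; []=⇒lookup; lookup⇒[]=)
open import Data.Product using (_,_; proj₁; proj₂; ∃-syntax)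
open import Data.Sum using (_⊎_; inj₁; inj₂; [_,_])
open import Data.Unit using (⊤; tt)
open import Data.Empty using (⊥-elim)
open import Relation.Nullary using (¬?; Dec; yes; no)
open import Relation.Binary.PropositionalEquality using (refl; sym; trans; cong; cong₂; subst; subst₂; _≢_; module ≡-Reasoning)
open import Data.List using (List; []; _∷_; map; _++_; length; upTo; applyUpTo; filter)
import Data.List.Membership.Propositional as List
open import Data.List.Membership.Propositional.Properties
  using (∈-map⁺; ∈-map⁻; ∈-++⁺ˡ; ∈-++⁺ʳ; ∈-++⁻; ∈-filter⁺; ∈-filter⁻; ∈-upTo⁺; ∈-upTo⁻; ∈-applyUpTo⁺)
open import Data.List.Membership.Propositional.Properties.WithK using (unique∧set⇒bag)
open import Data.List.Membership.DecPropositional _≟_ using () renaming (_∈?_ to _∈ℕ?_)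
open import Data.List.Properties using (filter-all; map-cong; map-cong-local; map-∘; length-map; length-++; ++-assoc; length-applyUpTo)
open import Data.List.Relation.Unary.Any using (here; there)
open import Data.List.Relation.Unary.All using (All; []; _∷_)
import Data.List.Relation.Unary.All as All
open import Data.List.Relation.Unary.All.Properties using (applyUpTo⁺₁) renaming (map⁺ to All-map⁺; ++⁺ to All-++⁺)
open import Data.List.Relation.Unary.AllPairs using (AllPairs; []; _∷_)
import Data.List.Relation.Unary.AllPairs.Properties as AllPairs
open import Data.List.Relation.Unary.Unique.Propositional using (Unique)
import Data.List.Relation.Unary.Unique.Propositional.Properties as Unique
open import Data.List.Relation.Binary.BagAndSetEquality using (∼bag⇒↭)
open import Data.List.Relation.Binary.Permutation.Propositional.Properties using (↭-length)
open import Function.Bundles using (mk⇔)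

private variable n : ℕ

-- Subsets of Fin n

∩⁺ : {p q : Subset n} {x : Fin n} → x ∈ p → x ∈ q → x ∈ p ∩ q
∩⁺ x∈p x∈q = x∈p∩q⁺ (x∈p , x∈q)

∩⁻ˡ : {p q : Subset n} {x : Fin n} → x ∈ p ∩ q → x ∈ p
∩⁻ˡ {p = p} {q} x∈p∩q = proj₁ (x∈p∩q⁻ p q x∈p∩q)

∩⁻ʳ : {p q : Subset n} {x : Fin n} → x ∈ p ∩ q → x ∈ q
∩⁻ʳ {p = p} {q} x∈p∩q = proj₂ (x∈p∩q⁻ p q x∈p∩q)

∪⁺ˡ : {p q : Subset n} {x : Fin n} → x ∈ p → x ∈ p ∪ q
∪⁺ˡ x∈p = x∈p∪q⁺ (inj₁ x∈p)

∪⁺ʳ : {p q : Subset n} {x : Fin n} → x ∈ q → x ∈ p ∪ q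
∪⁺ʳ x∈q = x∈p∪q⁺ (inj₂ x∈q)

∪⁻ : {p q : Subset n} {x : Fin n} → x ∈ p ∪ q → x ∈ p ⊎ x ∈ q
∪⁻ {p = p} {q} = x∈p∪q⁻ p q

∪⁻-∉ʳ : {p q : Subset n} {x : Fin n} → x ∈ p ∪ q → x ∉ q → x ∈ p
∪⁻-∉ʳ x∈p∪q x∉q = [ (λ x∈p → x∈p) , (λ x∈q → ⊥-elim (x∉q x∈q)) ] (∪⁻ x∈p∪q)

─⁺ : {p q : Subset n} {x : Fin n} → x ∈ p → x ∉ q → x ∈ p ─ q
─⁺ = x∈p∧x∉q⇒x∈p─q

─⁻ˡ : {p q : Subset n} {x : Fin n} → x ∈ p ─ q → x ∈ p
─⁻ˡ {p = inside ∷ p} {outside ∷ q} here = here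
─⁻ˡ {p = s ∷ p} {inside ∷ q} (there x∈p─q) = there (─⁻ˡ x∈p─q)
─⁻ˡ {p = s ∷ p} {outside ∷ q} (there x∈p─q) = there (─⁻ˡ x∈p─q)

─⁻ʳ : {p q : Subset n} {x : Fin n} → x ∈ p ─ q → x ∉ q
─⁻ʳ {p = inside ∷ p} {outside ∷ q} here ()
─⁻ʳ {p = s ∷ p} {inside ∷ q} (there x∈p─q) (there x∈q) = ─⁻ʳ x∈p─q x∈q
─⁻ʳ {p = s ∷ p} {outside ∷ q} (there x∈p─q) (there x∈q) = ─⁻ʳ x∈p─q x∈q

⋃⁺ : {ps : List (Subset n)} {p : Subset n} {x : Fin n} → p List.∈ ps → x ∈ p → x ∈ ⋃ ps
⋃⁺ (here refl) x∈p = ∪⁺ˡ x∈p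
⋃⁺ (there p∈ps) x∈p = ∪⁺ʳ (⋃⁺ p∈ps x∈p)

⋃⁻ : {ps : List (Subset n)} {x : Fin n} → x ∈ ⋃ ps → ∃[ p ] (p List.∈ ps × x ∈ p)
⋃⁻ {ps = []} x∈⊥ = ⊥-elim (∉⊥ x∈⊥)
⋃⁻ {ps = p ∷ ps} x∈⋃ with ∪⁻ {p = p} x∈⋃
... | inj₁ x∈p = p , here refl , x∈p
... | inj₂ x∈⋃ps with ⋃⁻ {ps = ps} x∈⋃ps
...   | q , q∈ps , x∈q = q , there q∈ps , x∈q

x≡y⇒x∈⁅y⁆ : {x y : Fin n} → x ≡ y → x ∈ ⁅ y ⁆
x≡y⇒x∈⁅y⁆ {y = y} refl = x∈⁅x⁆ y

∣p∪q∣+∣p∩q∣≡∣p∣+∣q∣ : (p q : Subset n) → ∣ p ∪ q ∣ + ∣ p ∩ q ∣ ≡ ∣ p ∣ + ∣ q ∣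
∣p∪q∣+∣p∩q∣≡∣p∣+∣q∣ [] [] = refl
∣p∪q∣+∣p∩q∣≡∣p∣+∣q∣ (inside ∷ p) (inside ∷ q) = cong suc (begin
  ∣ p ∪ q ∣ + suc (∣ p ∩ q ∣) ≡⟨ +-suc ∣ p ∪ q ∣ ∣ p ∩ q ∣ ⟩
  suc (∣ p ∪ q ∣ + ∣ p ∩ q ∣) ≡⟨ cong suc (∣p∪q∣+∣p∩q∣≡∣p∣+∣q∣ p q) ⟩
  suc (∣ p ∣ + ∣ q ∣)         ≡⟨ +-suc ∣ p ∣ ∣ q ∣ ⟨
  ∣ p ∣ + suc (∣ q ∣)         ∎)
  where open ≡-Reasoning
∣p∪q∣+∣p∩q∣≡∣p∣+∣q∣ (inside ∷ p) (outside ∷ q) = cong suc (∣p∪q∣+∣p∩q∣≡∣p∣+∣q∣ p q)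
∣p∪q∣+∣p∩q∣≡∣p∣+∣q∣ (outside ∷ p) (inside ∷ q) =
  trans (cong suc (∣p∪q∣+∣p∩q∣≡∣p∣+∣q∣ p q)) (sym (+-suc ∣ p ∣ ∣ q ∣))
∣p∪q∣+∣p∩q∣≡∣p∣+∣q∣ (outside ∷ p) (outside ∷ q) = ∣p∪q∣+∣p∩q∣≡∣p∣+∣q∣ p q

∣p─q∣+∣p∩q∣≡∣p∣ : (p q : Subset n) → ∣ p ─ q ∣ + ∣ p ∩ q ∣ ≡ ∣ p ∣
∣p─q∣+∣p∩q∣≡∣p∣ [] [] = refl
∣p─q∣+∣p∩q∣≡∣p∣ (inside ∷ p) (inside ∷ q) = trans (+-suc ∣ p ─ q ∣ ∣ p ∩ q ∣) (cong suc (∣p─q∣+∣p∩q∣≡∣p∣ p q))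
∣p─q∣+∣p∩q∣≡∣p∣ (inside ∷ p) (outside ∷ q) = cong suc (∣p─q∣+∣p∩q∣≡∣p∣ p q)
∣p─q∣+∣p∩q∣≡∣p∣ (outside ∷ p) (inside ∷ q) = ∣p─q∣+∣p∩q∣≡∣p∣ p q
∣p─q∣+∣p∩q∣≡∣p∣ (outside ∷ p) (outside ∷ q) = ∣p─q∣+∣p∩q∣≡∣p∣ p q

∣p∣≡1+m⇒Nonempty : (p : Subset n) {m : ℕ} → ∣ p ∣ ≡ suc m → Nonempty p
∣p∣≡1+m⇒Nonempty (inside ∷ p) _ = zero , here
∣p∣≡1+m⇒Nonempty (outside ∷ p) ∣p∣≡1+m with ∣p∣≡1+m⇒Nonempty p ∣p∣≡1+m
... | x , x∈p = suc x , there x∈p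

x∈p⇒∣p∣≢0 : {p : Subset n} {x : Fin n} → x ∈ p → ∣ p ∣ ≢ 0
x∈p⇒∣p∣≢0 {p = inside ∷ p} _ ()
x∈p⇒∣p∣≢0 {p = outside ∷ p} (there x∈p) = x∈p⇒∣p∣≢0 x∈p

p⊆q∧∣p∣≡∣q∣⇒p≡q : {p q : Subset n} → p ⊆ q → ∣ p ∣ ≡ ∣ q ∣ → p ≡ q
p⊆q∧∣p∣≡∣q∣⇒p≡q {p = []} {[]} _ _ = refl
p⊆q∧∣p∣≡∣q∣⇒p≡q {p = inside ∷ p} {inside ∷ q} p⊆q e =
  cong (inside ∷_) (p⊆q∧∣p∣≡∣q∣⇒p≡q (drop-∷-⊆ p⊆q) (suc-injective e))
p⊆q∧∣p∣≡∣q∣⇒p≡q {p = inside ∷ p} {outside ∷ q} p⊆q e with p⊆q here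
... | ()
p⊆q∧∣p∣≡∣q∣⇒p≡q {p = outside ∷ p} {inside ∷ q} p⊆q e =
  ⊥-elim (<⇒≱ ≤-refl (subst (_≤ ∣ q ∣) e (p⊆q⇒∣p∣≤∣q∣ (drop-∷-⊆ p⊆q))))
p⊆q∧∣p∣≡∣q∣⇒p≡q {p = outside ∷ p} {outside ∷ q} p⊆q e =
  cong (outside ∷_) (p⊆q∧∣p∣≡∣q∣⇒p≡q (drop-∷-⊆ p⊆q) e)

p∩q≡⊥⇒∣p∪q∣≡∣p∣+∣q∣ : (p q : Subset n) → p ∩ q ≡ ⊥ → ∣ p ∪ q ∣ ≡ ∣ p ∣ + ∣ q ∣
p∩q≡⊥⇒∣p∪q∣≡∣p∣+∣q∣ {n} p q p∩q≡⊥ = begin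
  ∣ p ∪ q ∣             ≡⟨ +-identityʳ _ ⟨
  ∣ p ∪ q ∣ + 0         ≡⟨ cong (∣ p ∪ q ∣ +_) (trans (cong ∣_∣ p∩q≡⊥) (∣⊥∣≡0 n)) ⟨
  ∣ p ∪ q ∣ + ∣ p ∩ q ∣ ≡⟨ ∣p∪q∣+∣p∩q∣≡∣p∣+∣q∣ p q ⟩
  ∣ p ∣ + ∣ q ∣         ∎
  where open ≡-Reasoning

x∉p⇒∣p∪⁅x⁆∣≡1+∣p∣ : (p : Subset n) (x : Fin n) → x ∉ p → ∣ p ∪ ⁅ x ⁆ ∣ ≡ suc ∣ p ∣
x∉p⇒∣p∪⁅x⁆∣≡1+∣p∣ p x x∉p = begin
  ∣ p ∪ ⁅ x ⁆ ∣     ≡⟨ p∩q≡⊥⇒∣p∪q∣≡∣p∣+∣q∣ p ⁅ x ⁆ p∩⁅x⁆≡⊥ ⟩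
  ∣ p ∣ + ∣ ⁅ x ⁆ ∣ ≡⟨ cong (∣ p ∣ +_) (∣⁅x⁆∣≡1 x) ⟩
  ∣ p ∣ + 1         ≡⟨ +-comm _ 1 ⟩
  suc ∣ p ∣         ∎
  where
  open ≡-Reasoning
  p∩⁅x⁆≡⊥ : p ∩ ⁅ x ⁆ ≡ ⊥
  p∩⁅x⁆≡⊥ = ⊆-antisym (λ h → ⊥-elim (x∉p (subst (_∈ p) (x∈⁅y⁆⇒x≡y x (∩⁻ʳ h)) (∩⁻ˡ h)))) (λ h → ⊥-elim (∉⊥ h))

x∈p⇒1+∣p─⁅x⁆∣≡∣p∣ : (p : Subset n) (x : Fin n) → x ∈ p → suc ∣ p ─ ⁅ x ⁆ ∣ ≡ ∣ p ∣
x∈p⇒1+∣p─⁅x⁆∣≡∣p∣ p x x∈p = begin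
  suc ∣ p ─ ⁅ x ⁆ ∣                 ≡⟨ +-comm 1 _ ⟩
  ∣ p ─ ⁅ x ⁆ ∣ + 1                 ≡⟨ cong (∣ p ─ ⁅ x ⁆ ∣ +_) (trans (cong ∣_∣ p∩⁅x⁆≡⁅x⁆) (∣⁅x⁆∣≡1 x)) ⟨
  ∣ p ─ ⁅ x ⁆ ∣ + ∣ p ∩ ⁅ x ⁆ ∣     ≡⟨ ∣p─q∣+∣p∩q∣≡∣p∣ p ⁅ x ⁆ ⟩
  ∣ p ∣                             ∎
  where
  open ≡-Reasoning
  p∩⁅x⁆≡⁅x⁆ : p ∩ ⁅ x ⁆ ≡ ⁅ x ⁆
  p∩⁅x⁆≡⁅x⁆ = ⊆-antisym ∩⁻ʳ (λ y∈⁅x⁆ → ∩⁺ (subst (_∈ p) (sym (x∈⁅y⁆⇒x≡y x y∈⁅x⁆)) x∈p) y∈⁅x⁆)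

∣p∣≡∣q∣⇒∣q─p∣≡∣p─q∣ : (p q : Subset n) → ∣ p ∣ ≡ ∣ q ∣ → ∣ q ─ p ∣ ≡ ∣ p ─ q ∣
∣p∣≡∣q∣⇒∣q─p∣≡∣p─q∣ p q ∣p∣≡∣q∣ = +-cancelʳ-≡ _ _ _ (begin
  ∣ q ─ p ∣ + ∣ q ∩ p ∣ ≡⟨ ∣p─q∣+∣p∩q∣≡∣p∣ q p ⟩
  ∣ q ∣                 ≡⟨ ∣p∣≡∣q∣ ⟨
  ∣ p ∣                 ≡⟨ ∣p─q∣+∣p∩q∣≡∣p∣ p q ⟨
  ∣ p ─ q ∣ + ∣ p ∩ q ∣ ≡⟨ cong (λ r → ∣ p ─ q ∣ + ∣ r ∣) (∩-comm p q) ⟩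
  ∣ p ─ q ∣ + ∣ q ∩ p ∣ ∎)
  where open ≡-Reasoning

∣p─q∣≡0⇒p⊆q : (p q : Subset n) → ∣ p ─ q ∣ ≡ 0 → p ⊆ q
∣p─q∣≡0⇒p⊆q p q ∣p─q∣≡0 {x} x∈p with x ∈? q
... | yes x∈q = x∈q
... | no x∉q = ⊥-elim (x∈p⇒∣p∣≢0 (─⁺ x∈p x∉q) ∣p─q∣≡0)

[p∪⁅y⁆]∩q≡p : {p q : Subset n} {y : Fin n} → p ⊆ q → y ∉ q → (p ∪ ⁅ y ⁆) ∩ q ≡ p
[p∪⁅y⁆]∩q≡p {p = p} {q} {y} p⊆q y∉q = ⊆-antisym ⊆ʳ (λ h → ∩⁺ (∪⁺ˡ h) (p⊆q h))
  where
  ⊆ʳ : (p ∪ ⁅ y ⁆) ∩ q ⊆ p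
  ⊆ʳ h with ∪⁻ (∩⁻ˡ h)
  ... | inj₁ x∈p = x∈p
  ... | inj₂ x∈⁅y⁆ = ⊥-elim (y∉q (subst (_∈ q) (x∈⁅y⁆⇒x≡y y x∈⁅y⁆) (∩⁻ʳ h)))

q∩[p∪⁅y⁆]≡p : {p q : Subset n} {y : Fin n} → p ⊆ q → y ∉ q → q ∩ (p ∪ ⁅ y ⁆) ≡ p
q∩[p∪⁅y⁆]≡p {p = p} {q} {y} p⊆q y∉q = trans (∩-comm q (p ∪ ⁅ y ⁆)) ([p∪⁅y⁆]∩q≡p p⊆q y∉q)

[p∪⁅y⁆]─q≡⁅y⁆ : {p q : Subset n} {y : Fin n} → p ⊆ q → y ∉ q → (p ∪ ⁅ y ⁆) ─ q ≡ ⁅ y ⁆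
[p∪⁅y⁆]─q≡⁅y⁆ {p = p} {q} {y} p⊆q y∉q =
  ⊆-antisym ⊆ʳ (λ h → ─⁺ (∪⁺ʳ h) (λ x∈q → y∉q (subst (_∈ q) (x∈⁅y⁆⇒x≡y y h) x∈q)))
  where
  ⊆ʳ : (p ∪ ⁅ y ⁆) ─ q ⊆ ⁅ y ⁆
  ⊆ʳ h with ∪⁻ (─⁻ˡ h)
  ... | inj₁ x∈p = ⊥-elim (─⁻ʳ h (p⊆q x∈p))
  ... | inj₂ x∈⁅y⁆ = x∈⁅y⁆

opaque
  preimage : (Fin n → Fin n) → Subset n → Subset n
  preimage τ S = tabulate (λ x → lookup S (τ x))

  preimage⁺ : {τ : Fin n → Fin n} {S : Subset n} {x : Fin n} → τ x ∈ S → x ∈ preimage τ S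
  preimage⁺ {x = x} h = lookup⇒[]= x _ (trans (lookup∘tabulate _ x) ([]=⇒lookup h))

  preimage⁻ : {τ : Fin n → Fin n} {S : Subset n} {x : Fin n} → x ∈ preimage τ S → τ x ∈ S
  preimage⁻ {τ = τ} {S} {x} h = lookup⇒[]= (τ x) S (trans (sym (lookup∘tabulate _ x)) ([]=⇒lookup h))

preimage-cong : {τ σ : Fin n → Fin n} → (∀ x → τ x ≡ σ x) → (S : Subset n) → preimage τ S ≡ preimage σ S
preimage-cong {τ = τ} {σ} τ≗σ S =
  ⊆-antisym (λ {x} h → preimage⁺ (subst (_∈ S) (τ≗σ x) (preimage⁻ h)))
            (λ {x} h → preimage⁺ (subst (_∈ S) (sym (τ≗σ x)) (preimage⁻ h)))

preimage-∩ : (τ : Fin n → Fin n) (p q : Subset n) → preimage τ (p ∩ q) ≡ preimage τ p ∩ preimage τ q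
preimage-∩ τ p q = ⊆-antisym (λ h → ∩⁺ (preimage⁺ (∩⁻ˡ (preimage⁻ h))) (preimage⁺ (∩⁻ʳ (preimage⁻ h))))
                             (λ h → preimage⁺ (∩⁺ (preimage⁻ (∩⁻ˡ h)) (preimage⁻ (∩⁻ʳ h))))

preimage-⊥ : (τ : Fin n → Fin n) → preimage τ ⊥ ≡ ⊥
preimage-⊥ τ = ⊆-antisym (λ h → ⊥-elim (∉⊥ (preimage⁻ h))) (λ h → ⊥-elim (∉⊥ h))

preimage-⋃ : (τ : Fin n → Fin n) (ps : List (Subset n)) → preimage τ (⋃ ps) ≡ ⋃ (map (preimage τ) ps)
preimage-⋃ τ ps = ⊆-antisym ⊆ʳ ⊇ʳ
  where
  ⊆ʳ : preimage τ (⋃ ps) ⊆ ⋃ (map (preimage τ) ps)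
  ⊆ʳ h with ⋃⁻ {ps = ps} (preimage⁻ {τ = τ} h)
  ... | p , p∈ps , τx∈p = ⋃⁺ (∈-map⁺ (preimage τ) p∈ps) (preimage⁺ {τ = τ} {S = p} τx∈p)
  ⊇ʳ : ⋃ (map (preimage τ) ps) ⊆ preimage τ (⋃ ps)
  ⊇ʳ h with ⋃⁻ {ps = map (preimage τ) ps} h
  ... | _ , q∈ps , x∈q with ∈-map⁻ (preimage τ) q∈ps
  ...   | p , p∈ps , refl = preimage⁺ {τ = τ} (⋃⁺ {ps = ps} p∈ps (preimage⁻ {τ = τ} {S = p} x∈q))

-- Transpositions and relabelling

transpose-cases : (u w x : Fin n) →
  (x ≡ u × transpose u w x ≡ w) ⊎ (x ≡ w × transpose u w x ≡ u) ⊎ (x ≢ u × x ≢ w × transpose u w x ≡ x)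
transpose-cases u w x with x Fin.≟ u
... | yes x≡u = inj₁ (x≡u , refl)
... | no x≢u with x Fin.≟ w
...   | yes x≡w = inj₂ (inj₁ (x≡w , refl))
...   | no x≢w = inj₂ (inj₂ (x≢u , x≢w , refl))

transpose-matchˡ : (u w : Fin n) → transpose u w u ≡ w
transpose-matchˡ u w with transpose-cases u w u
... | inj₁ (_ , e) = e
... | inj₂ (inj₁ (u≡w , e)) = trans e u≡w
... | inj₂ (inj₂ (u≢u , _)) = ⊥-elim (u≢u refl)

transpose-matchʳ : (u w : Fin n) → transpose u w w ≡ u
transpose-matchʳ u w with transpose-cases u w w
... | inj₁ (w≡u , e) = trans e w≡u
... | inj₂ (inj₁ (_ , e)) = e
... | inj₂ (inj₂ (_ , w≢w , _)) = ⊥-elim (w≢w refl)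

transpose-comm : (u w x : Fin n) → transpose u w x ≡ transpose w u x
transpose-comm u w x with transpose-cases u w x
... | inj₁ (refl , e) = trans e (sym (transpose-matchʳ w x))
... | inj₂ (inj₁ (refl , e)) = trans e (sym (transpose-matchˡ x u))
... | inj₂ (inj₂ (x≢u , x≢w , e)) with transpose-cases w u x
...   | inj₁ (x≡w , _) = ⊥-elim (x≢w x≡w)
...   | inj₂ (inj₁ (x≡u , _)) = ⊥-elim (x≢u x≡u)
...   | inj₂ (inj₂ (_ , _ , e′)) = trans e (sym e′)

transpose-involutive : (u w x : Fin n) → transpose u w (transpose u w x) ≡ x
transpose-involutive u w x = trans (cong (transpose u w) (transpose-comm u w x)) (transpose-inverse u w)

transpose-∈ : {X : Subset n} {u w x : Fin n} → u ∈ X → w ∈ X → x ∈ X → transpose u w x ∈ X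
transpose-∈ {X = X} {u} {w} {x} u∈X w∈X x∈X with transpose-cases u w x
... | inj₁ (_ , e) = subst (_∈ X) (sym e) w∈X
... | inj₂ (inj₁ (_ , e)) = subst (_∈ X) (sym e) u∈X
... | inj₂ (inj₂ (_ , _ , e)) = subst (_∈ X) (sym e) x∈X

preimage-transpose-exchange : (S : Subset n) (u w : Fin n) → u ∈ S → w ∉ S →
  preimage (transpose u w) S ≡ (S ─ ⁅ u ⁆) ∪ ⁅ w ⁆
preimage-transpose-exchange S u w u∈S w∉S = ⊆-antisym ⊆ʳ ⊇ʳ
  where
  ⊆ʳ : preimage (transpose u w) S ⊆ (S ─ ⁅ u ⁆) ∪ ⁅ w ⁆
  ⊆ʳ {x} h with transpose-cases u w x
  ... | inj₁ (_ , e) = ⊥-elim (w∉S (subst (_∈ S) e (preimage⁻ h)))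
  ... | inj₂ (inj₁ (refl , _)) = ∪⁺ʳ (x∈⁅x⁆ x)
  ... | inj₂ (inj₂ (x≢u , _ , e)) = ∪⁺ˡ (─⁺ (subst (_∈ S) e (preimage⁻ h)) (λ x∈⁅u⁆ → x≢u (x∈⁅y⁆⇒x≡y u x∈⁅u⁆)))
  ⊇ʳ : (S ─ ⁅ u ⁆) ∪ ⁅ w ⁆ ⊆ preimage (transpose u w) S
  ⊇ʳ {x} h with ∪⁻ h | transpose-cases u w x
  ... | inj₂ x∈⁅w⁆ | _ =
    preimage⁺ (subst (_∈ S) (sym (trans (cong (transpose u w) (x∈⁅y⁆⇒x≡y w x∈⁅w⁆)) (transpose-matchʳ u w))) u∈S)
  ... | inj₁ x∈S─u | inj₁ (x≡u , _) = ⊥-elim (─⁻ʳ x∈S─u (x≡y⇒x∈⁅y⁆ x≡u))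
  ... | inj₁ x∈S─u | inj₂ (inj₁ (refl , _)) = ⊥-elim (w∉S (─⁻ˡ x∈S─u))
  ... | inj₁ x∈S─u | inj₂ (inj₂ (_ , _ , e)) = preimage⁺ (subst (_∈ S) (sym e) (─⁻ˡ x∈S─u))

preimage-transpose-id : (S : Subset n) (u w : Fin n) → (u ∈ S → w ∈ S) → (w ∈ S → u ∈ S) →
  preimage (transpose u w) S ≡ S
preimage-transpose-id S u w u⇒w w⇒u = ⊆-antisym ⊆ʳ ⊇ʳ
  where
  ⊆ʳ : preimage (transpose u w) S ⊆ S
  ⊆ʳ {x} h with transpose-cases u w x
  ... | inj₁ (refl , e) = w⇒u (subst (_∈ S) e (preimage⁻ h))
  ... | inj₂ (inj₁ (refl , e)) = u⇒w (subst (_∈ S) e (preimage⁻ h))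
  ... | inj₂ (inj₂ (_ , _ , e)) = subst (_∈ S) e (preimage⁻ h)
  ⊇ʳ : S ⊆ preimage (transpose u w) S
  ⊇ʳ {x} h with transpose-cases u w x
  ... | inj₁ (refl , e) = preimage⁺ (subst (_∈ S) (sym e) (u⇒w h))
  ... | inj₂ (inj₁ (refl , e)) = preimage⁺ (subst (_∈ S) (sym e) (w⇒u h))
  ... | inj₂ (inj₂ (_ , _ , e)) = preimage⁺ (subst (_∈ S) (sym e) h)

∣preimage-transpose-exchange∣ : (S : Subset n) {u w : Fin n} → u ∈ S → w ∉ S →
  ∣ preimage (transpose u w) S ∣ ≡ ∣ S ∣
∣preimage-transpose-exchange∣ S {u} {w} u∈S w∉S = begin
  ∣ preimage (transpose u w) S ∣ ≡⟨ cong ∣_∣ (preimage-transpose-exchange S u w u∈S w∉S) ⟩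
  ∣ (S ─ ⁅ u ⁆) ∪ ⁅ w ⁆ ∣        ≡⟨ x∉p⇒∣p∪⁅x⁆∣≡1+∣p∣ (S ─ ⁅ u ⁆) w (λ h → w∉S (─⁻ˡ h)) ⟩
  suc ∣ S ─ ⁅ u ⁆ ∣              ≡⟨ x∈p⇒1+∣p─⁅x⁆∣≡∣p∣ S u u∈S ⟩
  ∣ S ∣                          ∎
  where open ≡-Reasoning

∣preimage-transpose∣ : (S : Subset n) (u w : Fin n) → ∣ preimage (transpose u w) S ∣ ≡ ∣ S ∣
∣preimage-transpose∣ S u w with u ∈? S | w ∈? S
... | yes u∈S | yes w∈S = cong ∣_∣ (preimage-transpose-id S u w (λ _ → w∈S) (λ _ → u∈S))
... | no u∉S | no w∉S = cong ∣_∣ (preimage-transpose-id S u w (λ h → ⊥-elim (u∉S h)) (λ h → ⊥-elim (w∉S h)))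
... | yes u∈S | no w∉S = ∣preimage-transpose-exchange∣ S u∈S w∉S
... | no u∉S | yes w∈S =
  trans (cong ∣_∣ (preimage-cong (transpose-comm u w) S)) (∣preimage-transpose-exchange∣ S w∈S u∉S)

transpose-shrinks-─ : (S W : Subset n) {u w : Fin n} → u ∈ S ─ W → w ∈ W ─ S →
  suc ∣ preimage (transpose u w) S ─ W ∣ ≡ ∣ S ─ W ∣
transpose-shrinks-─ S W {u} {w} u∈S─W w∈W─S = begin
  suc ∣ preimage (transpose u w) S ─ W ∣ ≡⟨ cong (λ T → suc ∣ T ─ W ∣) (preimage-transpose-exchange S u w (─⁻ˡ u∈S─W) (─⁻ʳ w∈W─S)) ⟩
  suc ∣ ((S ─ ⁅ u ⁆) ∪ ⁅ w ⁆) ─ W ∣      ≡⟨ cong (λ T → suc ∣ T ∣) (⊆-antisym ⊆ʳ ⊇ʳ) ⟩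
  suc ∣ (S ─ W) ─ ⁅ u ⁆ ∣                ≡⟨ x∈p⇒1+∣p─⁅x⁆∣≡∣p∣ (S ─ W) u u∈S─W ⟩
  ∣ S ─ W ∣                              ∎
  where
  open ≡-Reasoning
  ⊆ʳ : ((S ─ ⁅ u ⁆) ∪ ⁅ w ⁆) ─ W ⊆ (S ─ W) ─ ⁅ u ⁆
  ⊆ʳ h with ∪⁻ (─⁻ˡ h)
  ... | inj₁ x∈S─u = ─⁺ (─⁺ (─⁻ˡ x∈S─u) (─⁻ʳ h)) (─⁻ʳ x∈S─u)
  ... | inj₂ x∈⁅w⁆ = ⊥-elim (─⁻ʳ h (subst (_∈ W) (sym (x∈⁅y⁆⇒x≡y w x∈⁅w⁆)) (─⁻ˡ w∈W─S)))
  ⊇ʳ : (S ─ W) ─ ⁅ u ⁆ ⊆ ((S ─ ⁅ u ⁆) ∪ ⁅ w ⁆) ─ W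
  ⊇ʳ h = ─⁺ (∪⁺ˡ (─⁺ (─⁻ˡ (─⁻ˡ h)) (─⁻ʳ h))) (─⁻ʳ (─⁻ˡ h))

record Relabelling (X : Subset n) : Set where
  field
    τ            : Fin n → Fin n
    τ-involutive : ∀ x → τ (τ x) ≡ x
    τ-∈          : ∀ {x} → x ∈ X → τ x ∈ X
    ∣preimage∣   : ∀ S → ∣ preimage τ S ∣ ≡ ∣ S ∣

transposition : {X : Subset n} {u w : Fin n} → u ∈ X → w ∈ X → Relabelling X
transposition {u = u} {w} u∈X w∈X = record
  { τ = transpose u w
  ; τ-involutive = transpose-involutive u w
  ; τ-∈ = transpose-∈ u∈X w∈X
  ; ∣preimage∣ = λ S → ∣preimage-transpose∣ S u w
  }

unchanged-preimage : (τ : Fin n → Fin n) (B : ℕ → Subset n) (b : ℕ) (U₀ U_b : Subset n) (i : ℕ) →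
  unchanged (λ j → preimage τ (B j)) b (preimage τ U₀) (preimage τ U_b) i ≡ preimage τ (unchanged B b U₀ U_b i)
unchanged-preimage τ B b U₀ U_b zero = refl
unchanged-preimage τ B b U₀ U_b (suc i) with suc i ≟ b
... | yes _ = refl
... | no _ = sym (preimage-∩ τ (B (suc i)) (B (suc (suc i))))

module _ {X : Subset n} {v k b : ℕ} (ρ : Relabelling X) where
  open Relabelling ρ

  preimage-X : preimage τ X ≡ X
  preimage-X = ⊆-antisym (λ h → subst (_∈ X) (τ-involutive _) (τ-∈ (preimage⁻ h))) (λ h → preimage⁺ (τ-∈ h))

  relabelSCCD : SCCD X v k b → SCCD X v k b
  relabelSCCD D = record
    { B = λ i → preimage τ (B i)
    ; cardX = cardX
    ; block⊆X = λ i 1≤i i≤b h → subst (_∈ X) (τ-involutive _) (τ-∈ (block⊆X i 1≤i i≤b (preimage⁻ h)))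
    ; blockSize = λ i 1≤i i≤b → trans (∣preimage∣ (B i)) (blockSize i 1≤i i≤b)
    ; singleChg = λ i 1≤i i<b →
        trans (cong ∣_∣ (sym (preimage-∩ τ (B i) (B (suc i))))) (trans (∣preimage∣ _) (singleChg i 1≤i i<b))
    ; covering = covering′
    }
    where
    open SCCD D
    covering′ : ∀ (x y : Fin n) → x ∈ X → y ∈ X → x ≢ y →
      Σ ℕ λ i → 1 ≤ i × i ≤ b × x ∈ preimage τ (B i) × y ∈ preimage τ (B i)
    covering′ x y x∈X y∈X x≢y with covering (τ x) (τ y) (τ-∈ x∈X) (τ-∈ y∈X)
      (λ τx≡τy → x≢y (trans (sym (τ-involutive x)) (trans (cong τ τx≡τy) (τ-involutive y))))
    ... | i , 1≤i , i≤b , τx∈B , τy∈B = i , 1≤i , i≤b , preimage⁺ τx∈B , preimage⁺ τy∈B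

  relabelExpansionSet : {D : SCCD X v k b} → ExpansionSet D → ExpansionSet (relabelSCCD D)
  relabelExpansionSet {D} E = record
    { b≥1 = b≥1
    ; U0 = preimage τ U0
    ; Ub = preimage τ Ub
    ; U0⊆B1 = λ h → preimage⁺ (U0⊆B1 (preimage⁻ h))
    ; ∣U0∣ = trans (∣preimage∣ U0) ∣U0∣
    ; Ub⊆Bb = λ h → preimage⁺ (Ub⊆Bb (preimage⁻ h))
    ; ∣Ub∣ = trans (∣preimage∣ Ub) ∣Ub∣
    ; idx = idx
    ; idx≤b = idx≤b
    ; idxUniq = idxUniq
    ; idxCount = idxCount
    ; disjoint = λ i j i∈ j∈ i≢j → begin
        U′ i ∩ U′ j                           ≡⟨ cong₂ _∩_ (U′≡ i) (U′≡ j) ⟩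
        preimage τ (U i) ∩ preimage τ (U j)   ≡⟨ preimage-∩ τ (U i) (U j) ⟨
        preimage τ (U i ∩ U j)                ≡⟨ cong (preimage τ) (disjoint i j i∈ j∈ i≢j) ⟩
        preimage τ ⊥                          ≡⟨ preimage-⊥ τ ⟩
        ⊥                                     ∎
    ; cover = begin
        ⋃ (map U′ idx)                        ≡⟨ cong ⋃ (trans (map-cong U′≡ idx) (map-∘ idx)) ⟩
        ⋃ (map (preimage τ) (map U idx))      ≡⟨ preimage-⋃ τ (map U idx) ⟨
        preimage τ (⋃ (map U idx))            ≡⟨ cong (preimage τ) cover ⟩
        preimage τ X                          ≡⟨ preimage-X ⟩
        X                                     ∎
    }
    where
    open ≡-Reasoning
    open ExpansionSet E
    U′ : ℕ → Subset n
    U′ = unchanged (λ j → preimage τ (SCCD.B D j)) b (preimage τ U0) (preimage τ Ub)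
    U′≡ : ∀ i → U′ i ≡ preimage τ (U i)
    U′≡ = unchanged-preimage τ (SCCD.B D) b U0 Ub

record ExpandedSCCD (X : Subset n) (v k b : ℕ) : Set where
  constructor expanded
  field
    design    : SCCD X v k b
    expansion : ExpansionSet design
    bothEnds  : ContainsBothEnds expansion

relabel : {X : Subset n} {v k b : ℕ} → Relabelling X → ExpandedSCCD X v k b → ExpandedSCCD X v k b
relabel ρ (expanded D E ends) = expanded (relabelSCCD ρ D) (relabelExpansionSet ρ E) ends

module Alignment {X : Subset n} {v k b a : ℕ} (W : Subset n) (W⊆X : W ⊆ X) (∣W∣ : ∣ W ∣ ≡ a)
  (end : ExpandedSCCD X v k b → Subset n)
  (end-relabel : ∀ ρ P → end (relabel ρ P) ≡ preimage (Relabelling.τ ρ) (end P))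
  (end⊆X : ∀ P → end P ⊆ X) (∣end∣ : ∀ P → ∣ end P ∣ ≡ a) where

  alignEnd : ExpandedSCCD X v k b → Σ (ExpandedSCCD X v k b) λ P → end P ≡ W
  alignEnd P = go _ P refl
    where
    go : ∀ m P → ∣ end P ─ W ∣ ≡ m → Σ (ExpandedSCCD X v k b) λ P′ → end P′ ≡ W
    go zero P ∣end─W∣≡0 = P , p⊆q∧∣p∣≡∣q∣⇒p≡q (∣p─q∣≡0⇒p⊆q (end P) W ∣end─W∣≡0) (trans (∣end∣ P) (sym ∣W∣))
    go (suc m) P ∣end─W∣≡1+m with ∣p∣≡1+m⇒Nonempty (end P ─ W) ∣end─W∣≡1+m
      | ∣p∣≡1+m⇒Nonempty (W ─ end P) (trans (∣p∣≡∣q∣⇒∣q─p∣≡∣p─q∣ (end P) W (trans (∣end∣ P) (sym ∣W∣))) ∣end─W∣≡1+m)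
    ... | u , u∈end─W | w , w∈W─end = go m (relabel ρ P) (suc-injective (begin
      suc ∣ end (relabel ρ P) ─ W ∣               ≡⟨ cong (λ T → suc ∣ T ─ W ∣) (end-relabel ρ P) ⟩
      suc ∣ preimage (transpose u w) (end P) ─ W ∣ ≡⟨ transpose-shrinks-─ (end P) W u∈end─W w∈W─end ⟩
      ∣ end P ─ W ∣                               ≡⟨ ∣end─W∣≡1+m ⟩
      suc m                                       ∎))
      where
      open ≡-Reasoning
      ρ : Relabelling X
      ρ = transposition (end⊆X P (─⁻ˡ u∈end─W)) (W⊆X (─⁻ˡ w∈W─end))

members : Subset n → List (Fin n)
members [] = []
members (inside ∷ p) = zero ∷ map suc (members p)
members (outside ∷ p) = map suc (members p)

∈-members⁺ : {p : Subset n} {x : Fin n} → x ∈ p → x List.∈ members p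
∈-members⁺ {p = inside ∷ p} here = here refl
∈-members⁺ {p = inside ∷ p} (there x∈p) = there (∈-map⁺ suc (∈-members⁺ x∈p))
∈-members⁺ {p = outside ∷ p} (there x∈p) = ∈-map⁺ suc (∈-members⁺ x∈p)

∈-members⁻ : {p : Subset n} {x : Fin n} → x List.∈ members p → x ∈ p
∈-members⁻ {p = inside ∷ p} (here refl) = here
∈-members⁻ {p = inside ∷ p} (there x∈) with ∈-map⁻ suc x∈
... | _ , y∈ , refl = there (∈-members⁻ y∈)
∈-members⁻ {p = outside ∷ p} x∈ with ∈-map⁻ suc x∈
... | _ , y∈ , refl = there (∈-members⁻ y∈)

members-Unique : (p : Subset n) → Unique (members p)
members-Unique [] = []
members-Unique (inside ∷ p) = All-map⁺ (All.tabulate (λ _ ())) ∷ Unique.map⁺ Fin.suc-injective (members-Unique p)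
members-Unique (outside ∷ p) = Unique.map⁺ Fin.suc-injective (members-Unique p)

length-members : (p : Subset n) → length (members p) ≡ ∣ p ∣
length-members [] = refl
length-members (inside ∷ p) = cong suc (trans (length-map suc (members p)) (length-members p))
length-members (outside ∷ p) = trans (length-map suc (members p)) (length-members p)

Unique-same-members⇒length≡ : {A : Set} (xs ys : List A) → Unique xs → Unique ys →
  (∀ {x} → x List.∈ xs → x List.∈ ys) → (∀ {x} → x List.∈ ys → x List.∈ xs) → length xs ≡ length ys
Unique-same-members⇒length≡ xs ys xs! ys! xs⊆ys ys⊆xs = ↭-length (∼bag⇒↭ (unique∧set⇒bag xs! ys! (mk⇔ xs⊆ys ys⊆xs)))

range : ℕ → ℕ → List ℕ
range j zero = []
range j (suc m) = j ∷ range (suc j) m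

∈-range⁻ : ∀ {j m x} → x List.∈ range j m → j ≤ x × x < j + m
∈-range⁻ {j} {suc m} (here refl) = ≤-refl , m<m+n j (s≤s z≤n)
∈-range⁻ {j} {suc m} {x} (there x∈) with ∈-range⁻ {suc j} {m} x∈
... | 1+j≤x , x<1+j+m = ≤-trans (n≤1+n j) 1+j≤x , subst (x <_) (sym (+-suc j m)) x<1+j+m

∈-range⁺ : ∀ {j m x} → j ≤ x → x < j + m → x List.∈ range j m
∈-range⁺ {j} {zero} {x} j≤x x<j+0 = ⊥-elim (<⇒≱ x<j+0 (subst (_≤ x) (sym (+-identityʳ j)) j≤x))
∈-range⁺ {j} {suc m} {x} j≤x x<j+1+m with j ≟ x
... | yes refl = here refl
... | no j≢x = there (∈-range⁺ {suc j} {m} (≤∧≢⇒< j≤x j≢x) (subst (x <_) (+-suc j m) x<j+1+m))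

range-Unique : ∀ j m → Unique (range j m)
range-Unique j zero = []
range-Unique j (suc m) = All.tabulate (λ x∈ j≡x → <⇒≢ (proj₁ (∈-range⁻ x∈)) j≡x) ∷ range-Unique (suc j) m

1+length-filter-range≡length : (is : List ℕ) (b : ℕ) → Unique is → All (_≤ b) is → b List.∈ is →
  suc (length (filter (_∈ℕ? is) (range 0 b))) ≡ length is
1+length-filter-range≡length is b is! is≤b b∈is =
  Unique-same-members⇒length≡ (b ∷ below) is below! is! ⊆ʳ ⊇ʳ
  where
  below : List ℕ
  below = filter (_∈ℕ? is) (range 0 b)
  below! : Unique (b ∷ below)
  below! = All.tabulate (λ h b≡i → <⇒≢ (proj₂ (∈-range⁻ {0} {b} (proj₁ (∈-filter⁻ (_∈ℕ? is) {xs = range 0 b} h)))) (sym b≡i))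
         ∷ Unique.filter⁺ (_∈ℕ? is) (range-Unique 0 b)
  ⊆ʳ : ∀ {i} → i List.∈ b ∷ below → i List.∈ is
  ⊆ʳ (here refl) = b∈is
  ⊆ʳ (there h) = proj₂ (∈-filter⁻ (_∈ℕ? is) {xs = range 0 b} h)
  ⊇ʳ : ∀ {i} → i List.∈ is → i List.∈ b ∷ below
  ⊇ʳ {i} i∈is with i ≟ b
  ... | yes refl = here refl
  ... | no i≢b = there (∈-filter⁺ (_∈ℕ? is) (∈-range⁺ {0} {b} z≤n (≤∧≢⇒< (All.lookup is≤b i∈is) i≢b)) i∈is)

nonzero? : (j : ℕ) → Dec (j ≢ 0)
nonzero? j = ¬? (j ≟ 0)

1+length-filter-nonzero≡length : (is : List ℕ) → Unique is → 0 List.∈ is → suc (length (filter nonzero? is)) ≡ length is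
1+length-filter-nonzero≡length (zero ∷ is) (0∉is ∷ _) (here refl) =
  cong suc (cong length (filter-all nonzero? (All.map (λ 0≢i i≡0 → 0≢i (sym i≡0)) 0∉is)))
1+length-filter-nonzero≡length (suc i ∷ is) (_ ∷ is!) (there 0∈is) = cong suc (1+length-filter-nonzero≡length is is! 0∈is)
1+length-filter-nonzero≡length (zero ∷ is) (0∉is ∷ _) (there 0∈is) = ⊥-elim (All.lookup 0∉is 0∈is refl)

AllPairs-from-∈ : {A : Set} {R : A → A → Set} (xs : List A) →
  (∀ {i j} → i List.∈ xs → j List.∈ xs → i ≢ j → R i j) → Unique xs → AllPairs R xs
AllPairs-from-∈ [] _ _ = []
AllPairs-from-∈ (x ∷ xs) R-∈ (x∉xs ∷ xs!) =
  All.tabulate (λ y∈ → R-∈ (here refl) (there y∈) (All.lookup x∉xs y∈))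
  ∷ AllPairs-from-∈ xs (λ i∈ j∈ i≢j → R-∈ (there i∈) (there j∈) i≢j) xs!

AllPairs-∈ : {A : Set} {R : A → A → Set} {xs : List A} {x y : A} → AllPairs R xs →
  x List.∈ xs → y List.∈ xs → x ≢ y → R x y ⊎ R y x
AllPairs-∈ (_ ∷ _) (here refl) (here refl) x≢y = ⊥-elim (x≢y refl)
AllPairs-∈ (Rx ∷ _) (here refl) (there y∈) _ = inj₁ (All.lookup Rx y∈)
AllPairs-∈ (Ry ∷ _) (there x∈) (here refl) _ = inj₂ (All.lookup Ry x∈)
AllPairs-∈ (_ ∷ R*) (there x∈) (there y∈) x≢y = AllPairs-∈ R* x∈ y∈ x≢y

lookupOr : {A : Set} → A → List A → ℕ → A
lookupOr d [] i = d
lookupOr d (x ∷ xs) zero = x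
lookupOr d (x ∷ xs) (suc i) = lookupOr d xs i

lookupOr-All : {A : Set} {P : A → Set} {d : A} {xs : List A} → All P xs → ∀ i → i < length xs → P (lookupOr d xs i)
lookupOr-All (px ∷ _) zero _ = px
lookupOr-All (_ ∷ pxs) (suc i) (s≤s i<) = lookupOr-All pxs i i<

lookupOr-∈ : {A : Set} (d : A) (xs : List A) (i : ℕ) → i < length xs → lookupOr d xs i List.∈ xs
lookupOr-∈ d (x ∷ xs) zero _ = here refl
lookupOr-∈ d (x ∷ xs) (suc i) (s≤s i<) = there (lookupOr-∈ d xs i i<)

∈⇒lookupOr : {A : Set} {d z : A} {xs : List A} → z List.∈ xs → Σ ℕ λ i → i < length xs × lookupOr d xs i ≡ z
∈⇒lookupOr (here refl) = zero , s≤s z≤n , refl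
∈⇒lookupOr (there z∈) with ∈⇒lookupOr z∈
... | i , i< , e = suc i , s≤s i< , e

lookupOr-++ˡ : {A : Set} (d : A) (xs ys : List A) (i : ℕ) → i < length xs → lookupOr d (xs ++ ys) i ≡ lookupOr d xs i
lookupOr-++ˡ d (x ∷ xs) ys zero _ = refl
lookupOr-++ˡ d (x ∷ xs) ys (suc i) (s≤s i<) = lookupOr-++ˡ d xs ys i i<

lookupOr-++ʳ : {A : Set} (d : A) (xs ys : List A) (i : ℕ) → lookupOr d (xs ++ ys) (length xs + i) ≡ lookupOr d ys i
lookupOr-++ʳ d [] ys i = refl
lookupOr-++ʳ d (x ∷ xs) ys i = lookupOr-++ʳ d xs ys i

Chained : ℕ → List (Subset n) → Set
Chained a [] = ⊤
Chained a (x ∷ []) = ⊤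
Chained a (x ∷ y ∷ r) = ∣ x ∩ y ∣ ≡ a × Chained a (y ∷ r)

Chained-lookup : ∀ {a} (L : List (Subset n)) → Chained a L → ∀ i → suc i < length L →
  ∣ lookupOr ⊥ L i ∩ lookupOr ⊥ L (suc i) ∣ ≡ a
Chained-lookup (x ∷ []) _ zero (s≤s ())
Chained-lookup (x ∷ y ∷ r) (∣x∩y∣ , _) zero _ = ∣x∩y∣
Chained-lookup (x ∷ y ∷ r) (_ , chain) (suc i) (s≤s i<) = Chained-lookup (y ∷ r) chain i i<

-- Blocks are numbered from 1.
blockOf : List (Subset n) → ℕ → Subset n
blockOf L i = lookupOr ⊥ (⊥ ∷ L) i

sccdFromList : {Y : Subset n} {v : ℕ} (a : ℕ) (L : List (Subset n)) → ∣ Y ∣ ≡ v →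
  All (_⊆ Y) L → All (λ B → ∣ B ∣ ≡ suc a) L → Chained a L →
  (∀ (x y : Fin n) → x ∈ Y → y ∈ Y → x ≢ y → Σ (Subset n) λ B → B List.∈ L × x ∈ B × y ∈ B) →
  SCCD Y v (suc a) (length L)
sccdFromList a L ∣Y∣ L⊆Y ∣L∣ chain covers = record
  { B = blockOf L
  ; cardX = ∣Y∣
  ; block⊆X = λ { (suc i) _ i< → lookupOr-All L⊆Y i i< }
  ; blockSize = λ { (suc i) _ i< → lookupOr-All ∣L∣ i i< }
  ; singleChg = λ { (suc i) _ i< → Chained-lookup L chain i i< }
  ; covering = covering
  }
  where
  covering : ∀ (x y : Fin _) → _ → _ → x ≢ y →
    Σ ℕ λ i → 1 ≤ i × i ≤ length L × x ∈ blockOf L i × y ∈ blockOf L i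
  covering x y x∈Y y∈Y x≢y with covers x y x∈Y y∈Y x≢y
  ... | B , B∈L , x∈B , y∈B with ∈⇒lookupOr {d = ⊥} B∈L
  ...   | i , i< , e = suc i , s≤s z≤n , i< , subst (x ∈_) (sym e) x∈B , subst (y ∈_) (sym e) y∈B

unchanged-interior : (B : ℕ → Subset n) (b : ℕ) (U₀ U_b : Subset n) (i : ℕ) → suc i ≢ b →
  unchanged B b U₀ U_b (suc i) ≡ B (suc i) ∩ B (suc (suc i))
unchanged-interior B b U₀ U_b i 1+i≢b with suc i ≟ b
... | yes 1+i≡b = ⊥-elim (1+i≢b 1+i≡b)
... | no _ = refl

unchanged-last : (B : ℕ → Subset n) (b : ℕ) (U₀ U_b : Subset n) → 1 ≤ b → unchanged B b U₀ U_b b ≡ U_b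
unchanged-last B (suc b) U₀ U_b _ with suc b ≟ suc b
... | yes _ = refl
... | no b≢b = ⊥-elim (b≢b refl)

module ExpansionSetProperties {X : Subset n} {v k b : ℕ} {D : SCCD X v k b} (E : ExpansionSet D) where
  open SCCD D using (B; block⊆X; singleChg)
  open ExpansionSet E

  U-last : U b ≡ Ub
  U-last = unchanged-last B b U0 Ub b≥1

  U-interior : ∀ j → j < b → 1 ≤ j → U j ≡ B j ∩ B (suc j)
  U-interior (suc j) 1+j<b _ = unchanged-interior B b U0 Ub j (<⇒≢ 1+j<b)

  ∣U∣ : ∀ j → j < b → ∣ U j ∣ ≡ k ∸ 1
  ∣U∣ zero _ = ∣U0∣
  ∣U∣ (suc j) 1+j<b = trans (cong ∣_∣ (U-interior (suc j) 1+j<b (s≤s z≤n))) (singleChg (suc j) (s≤s z≤n) 1+j<b)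

  U⊆next : ∀ j → j < b → U j ⊆ B (suc j)
  U⊆next zero _ = U0⊆B1
  U⊆next (suc j) 1+j<b h = ∩⁻ʳ (subst (_ ∈_) (U-interior (suc j) 1+j<b (s≤s z≤n)) h)

  U⊆current : ∀ j → j < b → 1 ≤ j → U j ⊆ B j
  U⊆current j j<b 1≤j h = ∩⁻ˡ (subst (_ ∈_) (U-interior j j<b 1≤j) h)

  U⊆X : ∀ j → j < b → U j ⊆ X
  U⊆X j j<b h = block⊆X (suc j) (s≤s z≤n) j<b (U⊆next j j<b h)

  ∣part∣ : ∀ j → j List.∈ idx → ∣ U j ∣ ≡ k ∸ 1
  ∣part∣ j j∈ with j ≟ b
  ... | yes refl = trans (cong ∣_∣ U-last) ∣Ub∣
  ... | no j≢b = ∣U∣ j (≤∧≢⇒< (All.lookup idx≤b j∈) j≢b)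

  part⊆X : ∀ j → j List.∈ idx → U j ⊆ X
  part⊆X j j∈ h = subst (_ ∈_) cover (⋃⁺ (∈-map⁺ U j∈) h)

  parts-disjoint : ∀ i j → i List.∈ idx → j List.∈ idx → i ≢ j → ∀ {x} → x ∈ U i → x ∉ U j
  parts-disjoint i j i∈ j∈ i≢j x∈Ui x∈Uj = ∉⊥ (subst (_ ∈_) (disjoint i j i∈ j∈ i≢j) (∩⁺ x∈Ui x∈Uj))

extensions : Subset n → List (Fin n) → List (Subset n)
extensions P = map (λ y → P ∪ ⁅ y ⁆)

module _ {a : ℕ} {P z : Subset n} {R : List (Subset n)} (∣P∣ : ∣ P ∣ ≡ a) (P⊆z : P ⊆ z) where

  Chained-extensions : ∀ ys → Unique ys → (∀ {y} → y List.∈ ys → y ∉ z) →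
    Chained a (z ∷ R) → Chained a (extensions P ys ++ z ∷ R)
  Chained-extensions [] _ _ chain = chain
  Chained-extensions (y ∷ []) _ ∉z chain = trans (cong ∣_∣ ([p∪⁅y⁆]∩q≡p P⊆z (∉z (here refl)))) ∣P∣ , chain
  Chained-extensions (y ∷ y′ ∷ ys) (y∉ ∷ ys!) ∉z chain =
    trans (cong ∣_∣ ([p∪⁅y⁆]∩q≡p ∪⁺ˡ y∉P∪⁅y′⁆)) ∣P∣ , Chained-extensions (y′ ∷ ys) ys! (λ y∈ → ∉z (there y∈)) chain
    where
    y∉P∪⁅y′⁆ : y ∉ P ∪ ⁅ y′ ⁆
    y∉P∪⁅y′⁆ h = [ (λ y∈P → ∉z (here refl) (P⊆z y∈P)) , (λ y∈⁅y′⁆ → All.lookup y∉ (here refl) (x∈⁅y⁆⇒x≡y y′ y∈⁅y′⁆)) ] (∪⁻ h)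

  Chained-after-extensions : ∀ {x} ys → 0 < length ys → Unique ys → P ⊆ x → (∀ {y} → y List.∈ ys → y ∉ x × y ∉ z) →
    Chained a (z ∷ R) → Chained a (x ∷ extensions P ys ++ z ∷ R)
  Chained-after-extensions (y ∷ ys) _ ys! P⊆x ∉x,z chain =
    trans (cong ∣_∣ (q∩[p∪⁅y⁆]≡p P⊆x (proj₁ (∉x,z (here refl))))) ∣P∣ ,
    Chained-extensions (y ∷ ys) ys! (λ y∈ → proj₂ (∉x,z y∈)) chain

  lookup-extensions : ∀ ys → Unique ys → (∀ {y} → y List.∈ ys → y ∉ z) → (d : Fin n) → ∀ i → i < length ys →
    let L = extensions P ys ++ z ∷ R in
    lookupOr ⊥ L i ≡ P ∪ ⁅ lookupOr d ys i ⁆ × P ⊆ lookupOr ⊥ L (suc i) × lookupOr d ys i ∉ lookupOr ⊥ L (suc i)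
  lookup-extensions (y ∷ []) _ ∉z d zero _ = refl , P⊆z , ∉z (here refl)
  lookup-extensions (y ∷ y′ ∷ ys) (y∉ ∷ _) ∉z d zero _ =
    refl , ∪⁺ˡ , (λ h → [ (λ y∈P → ∉z (here refl) (P⊆z y∈P)) , (λ y∈⁅y′⁆ → All.lookup y∉ (here refl) (x∈⁅y⁆⇒x≡y y′ y∈⁅y′⁆)) ] (∪⁻ h))
  lookup-extensions (y ∷ ys) (_ ∷ ys!) ∉z d (suc i) (s≤s i<) = lookup-extensions ys ys! (λ y∈ → ∉z (there y∈)) d i i<

Chained-applyUpTo : {a : ℕ} (f : ℕ → Subset n) (m : ℕ) → (∀ i → i < m → ∣ f i ∩ f (suc i) ∣ ≡ a) →
  Chained a (f 0 ∷ applyUpTo (λ i → f (suc i)) m)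
Chained-applyUpTo f zero _ = tt
Chained-applyUpTo f (suc m) ∣f∩f∣ = ∣f∩f∣ 0 (s≤s z≤n) , Chained-applyUpTo (λ i → f (suc i)) m (λ i i<m → ∣f∩f∣ (suc i) (s≤s i<m))

lookupOr-applyUpTo : {A : Set} (d : A) (f : ℕ → A) (m i : ℕ) → i < m → lookupOr d (applyUpTo f m) i ≡ f i
lookupOr-applyUpTo d f (suc m) zero _ = refl
lookupOr-applyUpTo d f (suc m) (suc i) (s≤s i<m) = lookupOr-applyUpTo d (λ j → f (suc j)) m i i<m

-- Distinct indices need not be assumed: they follow from the parts being nonempty and pairwise disjoint.
module ExpansionSetFromParts {X : Subset n} {v k b : ℕ} (D : SCCD X v k b) (b≥1 : 1 ≤ b)
  (U₀ U_b : Subset n) (U₀⊆B₁ : U₀ ⊆ SCCD.B D 1) (∣U₀∣ : ∣ U₀ ∣ ≡ k ∸ 1)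
  (U_b⊆B_b : U_b ⊆ SCCD.B D b) (∣U_b∣ : ∣ U_b ∣ ≡ k ∸ 1)
  (parts : List (ℕ × Subset n))
  (parts-unchanged : All (λ (i , P) → unchanged (SCCD.B D) b U₀ U_b i ≡ P × i ≤ b) parts)
  (parts-disjoint : AllPairs (λ (_ , P) (_ , Q) → P ∩ Q ≡ ⊥) parts)
  (parts-nonempty : All (λ (_ , P) → Nonempty P) parts)
  (parts-cover : ⋃ (map proj₂ parts) ≡ X)
  (parts-count : (k ∸ 1) * length parts ≡ v) where

  U : ℕ → Subset n
  U = unchanged (SCCD.B D) b U₀ U_b

  Nonempty⇒p∩p≢⊥ : {P : Subset n} → Nonempty P → P ∩ P ≢ ⊥
  Nonempty⇒p∩p≢⊥ (x , x∈P) P∩P≡⊥ = ∉⊥ (subst (x ∈_) P∩P≡⊥ (∩⁺ x∈P x∈P))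

  indices-Unique : ∀ {qs} → All (λ (i , P) → U i ≡ P × i ≤ b) qs →
    AllPairs (λ (_ , P) (_ , Q) → P ∩ Q ≡ ⊥) qs → All (λ (_ , P) → Nonempty P) qs → Unique (map proj₁ qs)
  indices-Unique [] [] [] = []
  indices-Unique {(i , P) ∷ qs} ((Ui≡P , _) ∷ us) (P⊥ ∷ ds) (P≠∅ ∷ ns) = All-map⁺ (distinct us P⊥) ∷ indices-Unique us ds ns
    where
    distinct : ∀ {rs} → All (λ (i , P) → U i ≡ P × i ≤ b) rs →
      All (λ (_ , Q) → P ∩ Q ≡ ⊥) rs → All (λ (j , _) → i ≢ j) rs
    distinct [] [] = []
    distinct ((Uj≡Q , _) ∷ us) (P∩Q≡⊥ ∷ ds) =
      (λ i≡j → Nonempty⇒p∩p≢⊥ P≠∅ (trans (cong (P ∩_) (trans (sym Ui≡P) (trans (cong U i≡j) Uj≡Q))) P∩Q≡⊥))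
      ∷ distinct us ds

  expansionSet : ExpansionSet D
  expansionSet = record
    { b≥1 = b≥1 ; U0 = U₀ ; Ub = U_b ; U0⊆B1 = U₀⊆B₁ ; ∣U0∣ = ∣U₀∣ ; Ub⊆Bb = U_b⊆B_b ; ∣Ub∣ = ∣U_b∣
    ; idx = map proj₁ parts
    ; idx≤b = All-map⁺ (All.map proj₂ parts-unchanged)
    ; idxUniq = indices-Unique parts-unchanged parts-disjoint parts-nonempty
    ; idxCount = trans (cong ((k ∸ 1) *_) (length-map proj₁ parts)) parts-count
    ; disjoint = disjoint
    ; cover = trans (cong ⋃ (trans (sym (map-∘ parts)) (map-cong-local (All.map proj₁ parts-unchanged)))) parts-cover
    }
    where
    disjoint : ∀ i j → i List.∈ map proj₁ parts → j List.∈ map proj₁ parts → i ≢ j → U i ∩ U j ≡ ⊥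
    disjoint i j i∈ j∈ i≢j with ∈-map⁻ proj₁ i∈ | ∈-map⁻ proj₁ j∈
    ... | iP , iP∈ , refl | jQ , jQ∈ , refl =
      trans (cong₂ _∩_ (proj₁ (All.lookup parts-unchanged iP∈)) (proj₁ (All.lookup parts-unchanged jQ∈)))
        ([ (λ P∩Q≡⊥ → P∩Q≡⊥) , (λ Q∩P≡⊥ → trans (∩-comm _ _) Q∩P≡⊥) ]
          (AllPairs-∈ parts-disjoint iP∈ jQ∈ (λ iP≡jQ → i≢j (cong proj₁ iP≡jQ))))

-- Arithmetic of the parameters

C₂-+ : ∀ x y → (x + y) C 2 ≡ x C 2 + y C 2 + x * y
C₂-+ zero y = sym (+-identityʳ _)
C₂-+ (suc x) y = begin
  suc (x + y) C 2                          ≡⟨ nCk+nC[k+1]≡[n+1]C[k+1] (x + y) 1 ⟨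
  (x + y) C 1 + (x + y) C 2                ≡⟨ cong₂ _+_ (nC1≡n (x + y)) (C₂-+ x y) ⟩
  (x + y) + (x C 2 + y C 2 + x * y)        ≡⟨ solve 5 (λ x y cx cy xy → (x :+ y) :+ (cx :+ cy :+ xy)
                                                  := x :+ cx :+ cy :+ (y :+ xy)) refl x y (x C 2) (y C 2) (x * y) ⟩
  x + x C 2 + y C 2 + (y + x * y)          ≡⟨ cong (λ z → z + y C 2 + (y + x * y)) (begin
      x + x C 2                                 ≡⟨ cong (_+ x C 2) (nC1≡n x) ⟨
      x C 1 + x C 2                             ≡⟨ nCk+nC[k+1]≡[n+1]C[k+1] x 1 ⟩
      suc x C 2                                 ∎) ⟩
  suc x C 2 + y C 2 + suc x * y            ∎
  where
  open ≡-Reasoning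
  open +-*-Solver

m+[1+c]+1∸[2+c]≡m : ∀ m c → m + suc c + 1 ∸ suc (suc c) ≡ m
m+[1+c]+1∸[2+c]≡m m c = trans (cong (_∸ suc (suc c)) (+-comm (m + suc c) 1)) (m+n∸n≡m m (suc c))

inserted-count : ∀ c l t v v' → v ≡ suc c * suc l → v' ≡ t + suc c →
  ((v' + 1 ∸ suc (suc c)) * (v + 1 ∸ suc (suc c))) div (suc (suc c) ∸ 1) ≡ t * l
inserted-count c l t v v' refl refl = begin
  ((t + a + 1 ∸ suc a) * (a * suc l + 1 ∸ suc a)) / a ≡⟨ cong₂ (λ p q → (p * q) / a) (m+[1+c]+1∸[2+c]≡m t c) v-a≡al ⟩
  (t * (a * l)) / a                                  ≡⟨ cong (_/ a) (solve 3 (λ t a l → t :* (a :* l) := t :* l :* a) refl t a l) ⟩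
  (t * l * a) / a                                    ≡⟨ m*n/n≡m (t * l) a ⟩
  t * l                                              ∎
  where
  open ≡-Reasoning
  open +-*-Solver
  a = suc c
  v-a≡al : a * suc l + 1 ∸ suc a ≡ a * l
  v-a≡al = trans (cong (λ v → v + 1 ∸ suc a) (trans (*-suc a l) (+-comm a (a * l)))) (m+[1+c]+1∸[2+c]≡m (a * l) c)

-- The excess is an integer difference; an identity between such differences
-- is one between natural numbers once every subtrahend is moved across.
module _ where
  open import Data.Integer using (+_) renaming (_-_ to _-ℤ_)

  +-−-additive : ∀ x y z x₁ y₁ z₁ x₂ y₂ z₂ → x + y + z₁ + z₂ ≡ x₁ + y₁ + (x₂ + y₂) + z →
    (+ x +ℤ + y) -ℤ + z ≡ ((+ x₁ +ℤ + y₁) -ℤ + z₁) +ℤ ((+ x₂ +ℤ + y₂) -ℤ + z₂)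
  +-−-additive x y z x₁ y₁ z₁ x₂ y₂ z₂ eq = begin
    (+ x +ℤ + y) -ℤ + z                                        ≡⟨ solve 5 (λ x y z z₁ z₂ → (x :+ y) :- z
                                                                     := (x :+ y :+ z₁ :+ z₂) :- z :- z₁ :- z₂) refl (+ x) (+ y) (+ z) (+ z₁) (+ z₂) ⟩
    (+ x +ℤ + y +ℤ + z₁ +ℤ + z₂) -ℤ + z -ℤ + z₁ -ℤ + z₂         ≡⟨ cong (λ w → w -ℤ + z -ℤ + z₁ -ℤ + z₂) eqℤ ⟩
    (+ x₁ +ℤ + y₁ +ℤ (+ x₂ +ℤ + y₂) +ℤ + z) -ℤ + z -ℤ + z₁ -ℤ + z₂ ≡⟨ solve 7 (λ x₁ y₁ x₂ y₂ z z₁ z₂ →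
                                                                     (x₁ :+ y₁ :+ (x₂ :+ y₂) :+ z) :- z :- z₁ :- z₂
                                                                     := ((x₁ :+ y₁) :- z₁) :+ ((x₂ :+ y₂) :- z₂))
                                                                     refl (+ x₁) (+ y₁) (+ x₂) (+ y₂) (+ z) (+ z₁) (+ z₂) ⟩
    ((+ x₁ +ℤ + y₁) -ℤ + z₁) +ℤ ((+ x₂ +ℤ + y₂) -ℤ + z₂)       ∎
    where
    open ≡-Reasoning
    open Data.Integer.Solver.+-*-Solver
    eqℤ : + x +ℤ + y +ℤ + z₁ +ℤ + z₂ ≡ + x₁ +ℤ + y₁ +ℤ (+ x₂ +ℤ + y₂) +ℤ + z
    eqℤ = begin
      + x +ℤ + y +ℤ + z₁ +ℤ + z₂           ≡⟨ cong (λ w → w +ℤ + z₁ +ℤ + z₂) (ℤ.pos-+ x y) ⟨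
      + (x + y) +ℤ + z₁ +ℤ + z₂            ≡⟨ cong (_+ℤ + z₂) (ℤ.pos-+ (x + y) z₁) ⟨
      + (x + y + z₁) +ℤ + z₂               ≡⟨ ℤ.pos-+ (x + y + z₁) z₂ ⟨
      + (x + y + z₁ + z₂)                  ≡⟨ cong +_ eq ⟩
      + (x₁ + y₁ + (x₂ + y₂) + z)          ≡⟨ ℤ.pos-+ (x₁ + y₁ + (x₂ + y₂)) z ⟩
      + (x₁ + y₁ + (x₂ + y₂)) +ℤ + z       ≡⟨ cong (_+ℤ + z) (ℤ.pos-+ (x₁ + y₁) (x₂ + y₂)) ⟩
      + (x₁ + y₁) +ℤ + (x₂ + y₂) +ℤ + z    ≡⟨ cong (_+ℤ + z) (cong₂ _+ℤ_ (ℤ.pos-+ x₁ y₁) (ℤ.pos-+ x₂ y₂)) ⟩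
      + x₁ +ℤ + y₁ +ℤ (+ x₂ +ℤ + y₂) +ℤ + z ∎

excess-additive : ∀ c l t b b' v v' → v ≡ suc c * suc l → v' ≡ t + suc c →
  excess (v + v' + 1 ∸ suc (suc c)) (suc (suc c)) (b + b' + ((v' + 1 ∸ suc (suc c)) * (v + 1 ∸ suc (suc c))) div (suc (suc c) ∸ 1))
    ≡ excess v (suc (suc c)) b +ℤ excess v' (suc (suc c)) b'
excess-additive c l t b b' v v' v≡ v'≡ = begin
  excess (v + v' + 1 ∸ suc a) (suc a) (b + b' + _) ≡⟨ cong₂ (λ v* b* → excess v* (suc a) (b + b' + b*)) v*≡ (inserted-count c l t v v' v≡ v'≡) ⟩
  excess (v + t) (suc a) (b + b' + t * l)          ≡⟨ +-−-additive (a * (b + b' + t * l)) (a C 2) ((v + t) C 2) (a * b) (a C 2) (v C 2) (a * b') (a C 2) (v' C 2)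
                                                          (subst₂ counts (sym v≡) (sym v'≡) pairs) ⟩
  excess v (suc a) b +ℤ excess v' (suc a) b'       ∎
  where
  open ≡-Reasoning
  a = suc c
  v*≡ : v + v' + 1 ∸ suc a ≡ v + t
  v*≡ = trans (cong (λ w → v + w + 1 ∸ suc a) v'≡) (trans (cong (λ w → w + 1 ∸ suc a) (sym (+-assoc v t a)))
          (m+[1+c]+1∸[2+c]≡m (v + t) c))
  counts : ℕ → ℕ → Set
  counts v v' = a * (b + b' + t * l) + a C 2 + v C 2 + v' C 2 ≡ a * b + a C 2 + (a * b' + a C 2) + (v + t) C 2
  pairs : counts (a * suc l) (t + a)
  pairs = begin
    a * (b + b' + t * l) + a C 2 + (a * suc l) C 2 + (t + a) C 2
      ≡⟨ cong₂ (λ p q → a * (b + b' + t * l) + a C 2 + p + q) (cong (_C 2) (*-suc a l)) refl ⟩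
    a * (b + b' + t * l) + a C 2 + (a + a * l) C 2 + (t + a) C 2
      ≡⟨ cong₂ (λ p q → a * (b + b' + t * l) + a C 2 + p + q) (C₂-+ a (a * l)) (C₂-+ t a) ⟩
    a * (b + b' + t * l) + a C 2 + (a C 2 + (a * l) C 2 + a * (a * l)) + (t C 2 + a C 2 + t * a)
      ≡⟨ solve 8 (λ a b b' t l ca cs ct →
           a :* (b :+ b' :+ t :* l) :+ ca :+ (ca :+ cs :+ a :* (a :* l)) :+ (ct :+ ca :+ t :* a)
           := a :* b :+ ca :+ (a :* b' :+ ca) :+ ((ca :+ cs :+ a :* (a :* l)) :+ ct :+ (a :+ a :* l) :* t))
           refl a b b' t l (a C 2) ((a * l) C 2) (t C 2) ⟩
    a * b + a C 2 + (a * b' + a C 2) + ((a C 2 + (a * l) C 2 + a * (a * l)) + t C 2 + (a + a * l) * t)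
      ≡⟨ cong (λ p → a * b + a C 2 + (a * b' + a C 2) + p) (begin
           (a C 2 + (a * l) C 2 + a * (a * l)) + t C 2 + (a + a * l) * t ≡⟨ cong (λ p → p + t C 2 + (a + a * l) * t) (C₂-+ a (a * l)) ⟨
           (a + a * l) C 2 + t C 2 + (a + a * l) * t                     ≡⟨ C₂-+ (a + a * l) t ⟨
           (a + a * l + t) C 2                                           ≡⟨ cong (λ w → (w + t) C 2) (*-suc a l) ⟨
           (a * suc l + t) C 2                                           ∎) ⟩
    a * b + a C 2 + (a * b' + a C 2) + (a * suc l + t) C 2 ∎
    where open +-*-Solver

-- The concatenated design

module Concatenation {X X' : Subset n} (c bm bm' : ℕ) {v v' : ℕ}
  (D : SCCD X v (suc (suc c)) (suc bm)) (E : ExpansionSet D) (ends : ContainsBothEnds E)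
  (D' : SCCD X' v' (suc (suc c)) (suc bm')) (E' : ExpansionSet D') (ends' : ContainsBothEnds E')
  (∣W∣ : ∣ X ∩ X' ∣ ≡ suc c) (U_b≡W : ExpansionSet.Ub E ≡ X ∩ X') (U'₀≡W : ExpansionSet.U0 E' ≡ X ∩ X') where

  a b b' : ℕ
  a = suc c
  b = suc bm
  b' = suc bm'

  W : Subset n
  W = X ∩ X'

  module Design = SCCD D
  module Design' = SCCD D'
  module Expansion = ExpansionSet E
  module Expansion' = ExpansionSet E'
  open ExpansionSetProperties E
  module Parts' = ExpansionSetProperties E'
  open Design using (B)
  open Design' using () renaming (B to B')
  open Expansion using (U; idx)
  open Expansion' using () renaming (U to U'; idx to idx'; Ub to Q)

  Q⊆X' : Q ⊆ X'
  Q⊆X' h = Design'.block⊆X b' (s≤s z≤n) ≤-refl (Expansion'.Ub⊆Bb h)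

  x∈Q⇒x∉W : ∀ {x} → x ∈ Q → x ∉ W
  x∈Q⇒x∉W x∈Q x∈W = Parts'.parts-disjoint b' 0 (proj₂ ends') (proj₁ ends') (λ ())
    (subst (_ ∈_) (sym Parts'.U-last) x∈Q) (subst (_ ∈_) (sym U'₀≡W) x∈W)

  R : Subset n
  R = (X' ─ W) ─ Q

  -- Listing Q first makes the first a inserted blocks change exactly the points of Q.
  newPoints : List (Fin n)
  newPoints = members Q ++ members R

  newPoint⁻ : ∀ {y} → y List.∈ newPoints → y ∈ X' × y ∉ X
  newPoint⁻ {y} y∈ with ∈-++⁻ (members Q) y∈
  ... | inj₁ h = Q⊆X' y∈Q , λ y∈X → x∈Q⇒x∉W y∈Q (∩⁺ y∈X (Q⊆X' y∈Q))
    where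
    y∈Q : y ∈ Q
    y∈Q = ∈-members⁻ {p = Q} h
  ... | inj₂ h = ─⁻ˡ y∈X'─W , λ y∈X → ─⁻ʳ y∈X'─W (∩⁺ y∈X (─⁻ˡ y∈X'─W))
    where
    y∈X'─W : y ∈ X' ─ W
    y∈X'─W = ─⁻ˡ (∈-members⁻ {p = R} h)

  newPoint⁺ : ∀ {y} → y ∈ X' → y ∉ X → y List.∈ newPoints
  newPoint⁺ {y} y∈X' y∉X with y ∈? Q
  ... | yes y∈Q = ∈-++⁺ˡ (∈-members⁺ y∈Q)
  ... | no y∉Q = ∈-++⁺ʳ (members Q) (∈-members⁺ (─⁺ (─⁺ y∈X' (λ y∈W → y∉X (∩⁻ˡ y∈W))) y∉Q))

  newPoints-Unique : Unique newPoints
  newPoints-Unique = Unique.++⁺ (members-Unique Q) (members-Unique R)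
    (λ (y∈Q , y∈R) → ─⁻ʳ (∈-members⁻ {p = R} y∈R) (∈-members⁻ {p = Q} y∈Q))

  newPoint∉ : ∀ {y} {S : Subset n} → y List.∈ newPoints → S ⊆ X → y ∉ S
  newPoint∉ y∈ S⊆X y∈S = proj₂ (newPoint⁻ y∈) (S⊆X y∈S)

  t : ℕ
  t = length newPoints

  t≡a+∣R∣ : t ≡ a + ∣ R ∣
  t≡a+∣R∣ = trans (length-++ (members Q)) (cong₂ _+_ (trans (length-members Q) Expansion'.∣Ub∣) (length-members R))

  0<t : 0 < t
  0<t = subst (0 <_) (sym t≡a+∣R∣) (s≤s z≤n)

  t+a≡v' : t + a ≡ v'
  t+a≡v' = begin
    t + a                         ≡⟨ cong (_+ a) (trans t≡a+∣R∣ (+-comm a ∣ R ∣)) ⟩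
    ∣ R ∣ + a + a                 ≡⟨ cong (λ m → ∣ R ∣ + m + a) (trans (sym Expansion'.∣Ub∣) (cong ∣_∣ (sym [X'─W]∩Q≡Q))) ⟩
    ∣ R ∣ + ∣ (X' ─ W) ∩ Q ∣ + a  ≡⟨ cong (_+ a) (∣p─q∣+∣p∩q∣≡∣p∣ (X' ─ W) Q) ⟩
    ∣ X' ─ W ∣ + a                ≡⟨ cong (∣ X' ─ W ∣ +_) (trans (sym ∣W∣) (cong ∣_∣ (sym X'∩W≡W))) ⟩
    ∣ X' ─ W ∣ + ∣ X' ∩ W ∣       ≡⟨ ∣p─q∣+∣p∩q∣≡∣p∣ X' W ⟩
    ∣ X' ∣                        ≡⟨ Design'.cardX ⟩
    v'                            ∎
    where
    open ≡-Reasoning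
    [X'─W]∩Q≡Q : (X' ─ W) ∩ Q ≡ Q
    [X'─W]∩Q≡Q = ⊆-antisym ∩⁻ʳ (λ h → ∩⁺ (─⁺ (Q⊆X' h) (x∈Q⇒x∉W h)) h)
    X'∩W≡W : X' ∩ W ≡ W
    X'∩W≡W = ⊆-antisym ∩⁻ʳ (λ h → ∩⁺ (∩⁻ʳ h) h)

  insertions : ℕ → List (Subset n)
  insertions j with j ∈ℕ? idx
  ... | yes _ = extensions (U j) newPoints
  ... | no _ = []

  insertions-∈ : ∀ {j} → j List.∈ idx → insertions j ≡ extensions (U j) newPoints
  insertions-∈ {j} j∈ with j ∈ℕ? idx
  ... | yes _ = refl
  ... | no j∉ = ⊥-elim (j∉ j∈)

  -- The insertions at j go between B j and B (j + 1), or at the very start when j = 0.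
  spliced : ℕ → ℕ → List (Subset n) → List (Subset n)
  spliced j zero T = T
  spliced j (suc m) T = insertions j ++ B (suc j) ∷ spliced (suc j) m T

  blocks' : List (Subset n)
  blocks' = applyUpTo (λ i → B' (suc i)) b'

  blocks : List (Subset n)
  blocks = spliced 0 b blocks'

  B_b∩B'₁≡W : B b ∩ B' 1 ≡ W
  B_b∩B'₁≡W = ⊆-antisym
    (λ h → ∩⁺ (Design.block⊆X b (s≤s z≤n) ≤-refl (∩⁻ˡ h)) (Design'.block⊆X 1 ≤-refl (s≤s z≤n) (∩⁻ʳ h)))
    (λ h → ∩⁺ (Expansion.Ub⊆Bb (subst (_ ∈_) (sym U_b≡W) h)) (Expansion'.U0⊆B1 (subst (_ ∈_) (sym U'₀≡W) h)))

  Chained-spliced : ∀ m j → 1 ≤ j → j + m ≡ b → Chained a (B j ∷ spliced j m blocks')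
  Chained-spliced zero j _ j+0≡b rewrite +-identityʳ j | j+0≡b =
    trans (cong ∣_∣ B_b∩B'₁≡W) ∣W∣ ,
    Chained-applyUpTo (λ i → B' (suc i)) bm' (λ i i<bm' → Design'.singleChg (suc i) (s≤s z≤n) (s≤s i<bm'))
  Chained-spliced (suc m) j 1≤j j+1+m≡b with j ∈ℕ? idx
  ... | yes _ = Chained-after-extensions (∣U∣ j j<b) (U⊆next j j<b) newPoints 0<t newPoints-Unique (U⊆current j j<b 1≤j)
                  (λ y∈ → newPoint∉ y∈ (Design.block⊆X j 1≤j (<⇒≤ j<b)) , newPoint∉ y∈ (Design.block⊆X (suc j) (s≤s z≤n) j<b))
                  (Chained-spliced m (suc j) (s≤s z≤n) (trans (sym (+-suc j m)) j+1+m≡b))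
    where
    j<b : j < b
    j<b = subst (j <_) j+1+m≡b (m<m+n j (s≤s z≤n))
  ... | no _ = Design.singleChg j 1≤j j<b , Chained-spliced m (suc j) (s≤s z≤n) (trans (sym (+-suc j m)) j+1+m≡b)
    where
    j<b : j < b
    j<b = subst (j <_) j+1+m≡b (m<m+n j (s≤s z≤n))

  blocks-Chained : Chained a blocks
  blocks-Chained = subst (λ I → Chained a (I ++ B 1 ∷ spliced 1 bm blocks')) (sym (insertions-∈ (proj₁ ends)))
    (Chained-extensions (∣U∣ 0 (s≤s z≤n)) (U⊆next 0 (s≤s z≤n)) newPoints newPoints-Unique
      (λ y∈ → newPoint∉ y∈ (Design.block⊆X 1 ≤-refl (s≤s z≤n))) (Chained-spliced bm 1 ≤-refl refl))

  module EveryBlock (P : Subset n → Set)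
    (P-B : ∀ i → 1 ≤ i → i ≤ b → P (B i)) (P-B' : ∀ i → 1 ≤ i → i ≤ b' → P (B' i))
    (P-extension : ∀ j y → j < b → y List.∈ newPoints → P (U j ∪ ⁅ y ⁆)) where

    All-spliced : ∀ m j T → j + m ≤ b → All P T → All P (spliced j m T)
    All-spliced zero j T _ PT = PT
    All-spliced (suc m) j T j+1+m≤b PT =
      All-++⁺ All-insertions (P-B (suc j) (s≤s z≤n) (≤-trans (s≤s (m≤m+n j m)) 1+j+m≤b) ∷ All-spliced m (suc j) T 1+j+m≤b PT)
      where
      1+j+m≤b : suc j + m ≤ b
      1+j+m≤b = subst (_≤ b) (+-suc j m) j+1+m≤b
      All-insertions : All P (insertions j)
      All-insertions with j ∈ℕ? idx
      ... | yes _ = All-map⁺ (All.tabulate (P-extension j _ (≤-trans (m<m+n j (s≤s z≤n)) j+1+m≤b)))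
      ... | no _ = []

    All-blocks : All P blocks
    All-blocks = All-spliced b 0 blocks' ≤-refl (applyUpTo⁺₁ (λ i → B' (suc i)) b' (P-B' _ (s≤s z≤n)))

  T⊆spliced : ∀ m j T {Z} → Z List.∈ T → Z List.∈ spliced j m T
  T⊆spliced zero j T Z∈ = Z∈
  T⊆spliced (suc m) j T Z∈ = ∈-++⁺ʳ (insertions j) (there (T⊆spliced m (suc j) T Z∈))

  B∈spliced : ∀ m j T i → j < i → i ≤ j + m → B i List.∈ spliced j m T
  B∈spliced zero j T i j<i i≤j+0 = ⊥-elim (<⇒≱ j<i (subst (i ≤_) (+-identityʳ j) i≤j+0))
  B∈spliced (suc m) j T i j<i i≤j+1+m with suc j ≟ i
  ... | yes refl = ∈-++⁺ʳ (insertions j) (here refl)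
  ... | no 1+j≢i = ∈-++⁺ʳ (insertions j)
    (there (B∈spliced m (suc j) T i (≤∧≢⇒< j<i 1+j≢i) (subst (i ≤_) (+-suc j m) i≤j+1+m)))

  extension∈spliced : ∀ m j T i y → j ≤ i → i < j + m → i List.∈ idx → y List.∈ newPoints →
    U i ∪ ⁅ y ⁆ List.∈ spliced j m T
  extension∈spliced zero j T i y j≤i i<j+0 _ _ = ⊥-elim (<⇒≱ i<j+0 (subst (_≤ i) (sym (+-identityʳ j)) j≤i))
  extension∈spliced (suc m) j T i y j≤i i<j+1+m i∈ y∈ with j ≟ i
  ... | yes refl = ∈-++⁺ˡ (subst ((U j ∪ ⁅ y ⁆) List.∈_) (sym (insertions-∈ i∈)) (∈-map⁺ (λ y → U j ∪ ⁅ y ⁆) y∈))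
  ... | no j≢i = ∈-++⁺ʳ (insertions j)
    (there (extension∈spliced m (suc j) T i y (≤∧≢⇒< j≤i j≢i) (subst (i <_) (+-suc j m) i<j+1+m) i∈ y∈))

  indicesIn : ℕ → ℕ → ℕ
  indicesIn j m = length (filter (_∈ℕ? idx) (range j m))

  length-spliced : ∀ m j T → length (spliced j m T) ≡ m + indicesIn j m * t + length T
  length-spliced zero j T = refl
  length-spliced (suc m) j T with j ∈ℕ? idx
  ... | yes _ = begin
    length (extensions (U j) newPoints ++ B (suc j) ∷ spliced (suc j) m T)
      ≡⟨ length-++ (extensions (U j) newPoints) ⟩
    length (extensions (U j) newPoints) + suc (length (spliced (suc j) m T))
      ≡⟨ cong₂ _+_ (length-map _ newPoints) (cong suc (length-spliced m (suc j) T)) ⟩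
    t + suc (m + indicesIn (suc j) m * t + length T)
      ≡⟨ solve 4 (λ t m i T → t :+ (con 1 :+ (m :+ i :* t :+ T)) := con 1 :+ m :+ (con 1 :+ i) :* t :+ T)
           refl t m (indicesIn (suc j) m) (length T) ⟩
    suc m + suc (indicesIn (suc j) m) * t + length T ∎
    where
    open ≡-Reasoning
    open +-*-Solver
  ... | no _ = cong suc (length-spliced m (suc j) T)

  l : ℕ
  l = indicesIn 0 b

  1+l≡∣idx∣ : suc l ≡ length idx
  1+l≡∣idx∣ = 1+length-filter-range≡length idx b Expansion.idxUniq Expansion.idx≤b (proj₂ ends)

  v≡a*[1+l] : v ≡ a * suc l
  v≡a*[1+l] = trans (sym Expansion.idxCount) (cong (a *_) (sym 1+l≡∣idx∣))

  length-blocks : length blocks ≡ b + b' + t * l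
  length-blocks = trans (length-spliced b 0 blocks') (trans (cong (λ m → b + l * t + m) (length-applyUpTo (λ i → B' (suc i)) b'))
    (solve 4 (λ b b' t l → b :+ l :* t :+ b' := b :+ b' :+ t :* l) refl b b' t l))
    where open +-*-Solver

  Covered : Fin n → Fin n → Set
  Covered x y = Σ (Subset n) λ Z → Z List.∈ blocks × x ∈ Z × y ∈ Z

  covered-in-X : ∀ {x y} → x ∈ X → y ∈ X → x ≢ y → Covered x y
  covered-in-X {x} {y} x∈X y∈X x≢y with Design.covering x y x∈X y∈X x≢y
  ... | i , 1≤i , i≤b , x∈B , y∈B = B i , B∈spliced b 0 blocks' i 1≤i i≤b , x∈B , y∈B

  covered-in-X' : ∀ {x y} → x ∈ X' → y ∈ X' → x ≢ y → Covered x y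
  covered-in-X' {x} {y} x∈X' y∈X' x≢y with Design'.covering x y x∈X' y∈X' x≢y
  ... | suc i , _ , i<b' , x∈B' , y∈B' = B' (suc i) , T⊆spliced b 0 blocks' (∈-applyUpTo⁺ (λ i → B' (suc i)) i<b') , x∈B' , y∈B'

  -- x lies in a part U j with j < b (as U b = W ⊆ X'), and the block U j ∪ {y} was inserted.
  covered-across : ∀ {x y} → x ∈ X → x ∉ X' → y ∈ X' → y ∉ X → Covered x y
  covered-across {x} {y} x∈X x∉X' y∈X' y∉X with ⋃⁻ {ps = map U idx} (subst (x ∈_) (sym Expansion.cover) x∈X)
  ... | _ , P∈ , x∈P with ∈-map⁻ U P∈
  ... | j , j∈ , refl = U j ∪ ⁅ y ⁆ , extension∈spliced b 0 blocks' j y z≤n j<b j∈ (newPoint⁺ y∈X' y∉X) , ∪⁺ˡ x∈P , ∪⁺ʳ (x∈⁅x⁆ y)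
    where
    j<b : j < b
    j<b = ≤∧≢⇒< (All.lookup Expansion.idx≤b j∈) (λ { refl → x∉X' (∩⁻ʳ (subst (x ∈_) (trans U-last U_b≡W) x∈P)) })

  blocks-cover : ∀ (x y : Fin n) → x ∈ X ∪ X' → y ∈ X ∪ X' → x ≢ y → Covered x y
  blocks-cover x y x∈ y∈ x≢y with x ∈? X' | y ∈? X'
  ... | yes x∈X' | yes y∈X' = covered-in-X' x∈X' y∈X' x≢y
  ... | no x∉X' | no y∉X' = covered-in-X (∪⁻-∉ʳ x∈ x∉X') (∪⁻-∉ʳ y∈ y∉X') x≢y
  ... | no x∉X' | yes y∈X' with y ∈? X
  ...   | yes y∈X = covered-in-X (∪⁻-∉ʳ x∈ x∉X') y∈X x≢y
  ...   | no y∉X = covered-across (∪⁻-∉ʳ x∈ x∉X') x∉X' y∈X' y∉X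
  blocks-cover x y x∈ y∈ x≢y | yes x∈X' | no y∉X' with x ∈? X
  ...   | yes x∈X = covered-in-X x∈X (∪⁻-∉ʳ y∈ y∉X') x≢y
  ...   | no x∉X = let Z , Z∈ , y∈Z , x∈Z = covered-across (∪⁻-∉ʳ y∈ y∉X') y∉X' x∈X' x∉X in Z , Z∈ , x∈Z , y∈Z

  ∣extension∣ : ∀ j y → j < b → y List.∈ newPoints → ∣ U j ∪ ⁅ y ⁆ ∣ ≡ suc a
  ∣extension∣ j y j<b y∈ = trans (x∉p⇒∣p∪⁅x⁆∣≡1+∣p∣ (U j) y (newPoint∉ y∈ (U⊆X j j<b))) (cong suc (∣U∣ j j<b))

  extension⊆X∪X' : ∀ j y → j < b → y List.∈ newPoints → U j ∪ ⁅ y ⁆ ⊆ X ∪ X'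
  extension⊆X∪X' j y j<b y∈ h =
    [ (λ x∈U → ∪⁺ˡ (U⊆X j j<b x∈U)) , (λ x∈⁅y⁆ → ∪⁺ʳ (subst (_∈ X') (sym (x∈⁅y⁆⇒x≡y y x∈⁅y⁆)) (proj₁ (newPoint⁻ y∈)))) ] (∪⁻ h)

  ∣X∪X'∣ : ∣ X ∪ X' ∣ ≡ v + v' + 1 ∸ suc a
  ∣X∪X'∣ = sym (begin
    v + v' + 1 ∸ suc a           ≡⟨ cong (_∸ suc a) (+-comm (v + v') 1) ⟩
    v + v' ∸ a                   ≡⟨ cong (_∸ a) (cong₂ _+_ Design.cardX Design'.cardX) ⟨
    ∣ X ∣ + ∣ X' ∣ ∸ a           ≡⟨ cong (_∸ a) (∣p∪q∣+∣p∩q∣≡∣p∣+∣q∣ X X') ⟨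
    ∣ X ∪ X' ∣ + ∣ X ∩ X' ∣ ∸ a  ≡⟨ cong (λ m → ∣ X ∪ X' ∣ + m ∸ a) ∣W∣ ⟩
    ∣ X ∪ X' ∣ + a ∸ a           ≡⟨ m+n∸n≡m ∣ X ∪ X' ∣ a ⟩
    ∣ X ∪ X' ∣                   ∎)
    where open ≡-Reasoning

  D* : SCCD (X ∪ X') (v + v' + 1 ∸ suc (suc c)) (suc (suc c)) (length blocks)
  D* = sccdFromList a blocks ∣X∪X'∣
    (EveryBlock.All-blocks (_⊆ X ∪ X') (λ i 1≤i i≤b h → ∪⁺ˡ (Design.block⊆X i 1≤i i≤b h))
      (λ i 1≤i i≤b' h → ∪⁺ʳ (Design'.block⊆X i 1≤i i≤b' h)) extension⊆X∪X')
    (EveryBlock.All-blocks (λ Z → ∣ Z ∣ ≡ suc a) Design.blockSize Design'.blockSize ∣extension∣)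
    blocks-Chained blocks-cover

  B* : ℕ → Subset n
  B* = blockOf blocks

  U* : ℕ → Subset n
  U* = unchanged B* (length blocks) Expansion.U0 Q

  U*-interior : ∀ i → suc i < length blocks → U* (suc i) ≡ B* (suc i) ∩ B* (suc (suc i))
  U*-interior i 1+i< = unchanged-interior B* (length blocks) Expansion.U0 Q i (<⇒≢ 1+i<)

  U*-between : ∀ pre Z Z′ rest → blocks ≡ pre ++ Z ∷ Z′ ∷ rest →
    U* (suc (length pre)) ≡ Z ∩ Z′ × suc (length pre) ≤ length blocks
  U*-between pre Z Z′ rest blocks≡ = (begin
    U* (suc (length pre))                                ≡⟨ U*-interior (length pre) 1+∣pre∣<∣blocks∣ ⟩
    B* (suc (length pre)) ∩ B* (suc (suc (length pre)))  ≡⟨ cong₂ _∩_ (B*≡ 0 (+-identityʳ _)) (B*≡ 1 (+-comm (length pre) 1)) ⟩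
    Z ∩ Z′                                               ∎) ,
    <⇒≤ 1+∣pre∣<∣blocks∣
    where
    open ≡-Reasoning
    B*≡ : ∀ i {p} → length pre + i ≡ p → B* (suc p) ≡ lookupOr ⊥ (Z ∷ Z′ ∷ rest) i
    B*≡ i refl = trans (cong (λ L → lookupOr ⊥ L (length pre + i)) blocks≡) (lookupOr-++ʳ ⊥ pre (Z ∷ Z′ ∷ rest) i)
    1+∣pre∣<∣blocks∣ : suc (length pre) < length blocks
    1+∣pre∣<∣blocks∣ = subst (suc (length pre) <_) (sym (trans (cong length blocks≡) (length-++ pre)))
      (≤-trans (s≤s (s≤s (m≤m+n (length pre) (length rest))))
        (≤-reflexive (sym (trans (+-suc (length pre) (suc (length rest))) (cong suc (+-suc (length pre) (length rest)))))))

  spliced-+ : ∀ m₁ j m₂ T → spliced j (m₁ + m₂) T ≡ spliced j m₁ [] ++ spliced (j + m₁) m₂ T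
  spliced-+ zero j m₂ T = cong (λ i → spliced i m₂ T) (sym (+-identityʳ j))
  spliced-+ (suc m₁) j m₂ T = begin
    insertions j ++ B (suc j) ∷ spliced (suc j) (m₁ + m₂) T
      ≡⟨ cong (λ L → insertions j ++ B (suc j) ∷ L) (spliced-+ m₁ (suc j) m₂ T) ⟩
    insertions j ++ B (suc j) ∷ spliced (suc j) m₁ [] ++ spliced (suc j + m₁) m₂ T
      ≡⟨ cong (λ i → insertions j ++ B (suc j) ∷ spliced (suc j) m₁ [] ++ spliced i m₂ T) (sym (+-suc j m₁)) ⟩
    insertions j ++ B (suc j) ∷ spliced (suc j) m₁ [] ++ spliced (j + suc m₁) m₂ T
      ≡⟨ ++-assoc (insertions j) (B (suc j) ∷ spliced (suc j) m₁ []) (spliced (j + suc m₁) m₂ T) ⟨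
    (insertions j ++ B (suc j) ∷ spliced (suc j) m₁ []) ++ spliced (j + suc m₁) m₂ T ∎
    where open ≡-Reasoning

  blocks-around : ∀ j m → suc j + m ≡ b →
    blocks ≡ (spliced 0 j [] ++ insertions j) ++ B (suc j) ∷ spliced (suc j) m blocks'
  blocks-around j m 1+j+m≡b = begin
    spliced 0 b blocks'                                                   ≡⟨ cong (λ i → spliced 0 i blocks') (trans (sym 1+j+m≡b) (sym (+-suc j m))) ⟩
    spliced 0 (j + suc m) blocks'                                         ≡⟨ spliced-+ j 0 (suc m) blocks' ⟩
    spliced 0 j [] ++ insertions j ++ B (suc j) ∷ spliced (suc j) m blocks' ≡⟨ ++-assoc (spliced 0 j []) (insertions j) _ ⟨
    (spliced 0 j [] ++ insertions j) ++ B (suc j) ∷ spliced (suc j) m blocks' ∎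
    where open ≡-Reasoning

  -- position j is the number of the block B j in the concatenated list; position 0 stands for U₀.
  position : ℕ → ℕ
  position zero = 0
  position (suc j) = suc (length (spliced 0 j [] ++ insertions j))

  U*-position-suc : ∀ j m → suc j + m ≡ b → suc j List.∈ idx → U* (position (suc j)) ≡ U (suc j) × position (suc j) ≤ length blocks
  U*-position-suc j zero 1+j+0≡b _ with U*-between _ _ _ _ (blocks-around j zero 1+j+0≡b)
  ... | U*≡ , ≤∣blocks∣ = trans U*≡ (begin
    B (suc j) ∩ B' 1 ≡⟨ cong (λ i → B i ∩ B' 1) 1+j≡b ⟩
    B b ∩ B' 1       ≡⟨ B_b∩B'₁≡W ⟩
    W                ≡⟨ trans U-last U_b≡W ⟨
    U b              ≡⟨ cong U 1+j≡b ⟨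
    U (suc j)        ∎) , ≤∣blocks∣
    where
    open ≡-Reasoning
    1+j≡b : suc j ≡ b
    1+j≡b = trans (sym (+-identityʳ (suc j))) 1+j+0≡b
  U*-position-suc j (suc m) 1+j+1+m≡b 1+j∈ =
    first-insertion newPoints 0<t (λ y∈ → newPoint∉ y∈ (Design.block⊆X (suc j) (s≤s z≤n) (<⇒≤ 1+j<b)))
      (trans (blocks-around j (suc m) 1+j+1+m≡b) (cong (λ I → before ++ B (suc j) ∷ I ++ after) (insertions-∈ 1+j∈)))
    where
    before after : List (Subset n)
    before = spliced 0 j [] ++ insertions j
    after = B (suc (suc j)) ∷ spliced (suc (suc j)) m blocks'
    1+j<b : suc j < b
    1+j<b = subst (suc j <_) 1+j+1+m≡b (m<m+n (suc j) (s≤s z≤n))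
    first-insertion : ∀ ys → 0 < length ys → (∀ {y} → y List.∈ ys → y ∉ B (suc j)) →
      blocks ≡ before ++ B (suc j) ∷ extensions (U (suc j)) ys ++ after →
      U* (position (suc j)) ≡ U (suc j) × position (suc j) ≤ length blocks
    first-insertion (y ∷ ys) _ ∉B blocks≡ with U*-between _ _ _ _ blocks≡
    ... | U*≡ , ≤∣blocks∣ = trans U*≡ (q∩[p∪⁅y⁆]≡p (U⊆current (suc j) 1+j<b (s≤s z≤n)) (∉B (here refl))) , ≤∣blocks∣

  U*-position : ∀ j → j List.∈ idx → U* (position j) ≡ U j × position j ≤ length blocks
  U*-position zero _ = refl , z≤n
  U*-position (suc j) j∈ = U*-position-suc j (bm ∸ j) (cong suc (m+[n∸m]≡n (s≤s⁻¹ (All.lookup Expansion.idx≤b j∈)))) j∈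

  N : ℕ
  N = length (spliced 0 b [])

  length-blocks≡N+b' : length blocks ≡ N + b'
  length-blocks≡N+b' = begin
    length (spliced 0 b blocks')          ≡⟨ cong length (trans (cong (λ i → spliced 0 i blocks') (sym (+-identityʳ b))) (spliced-+ b 0 0 blocks')) ⟩
    length (spliced 0 b [] ++ blocks')    ≡⟨ length-++ (spliced 0 b []) ⟩
    N + length blocks'                    ≡⟨ cong (N +_) (length-applyUpTo (λ i → B' (suc i)) b') ⟩
    N + b'                                ∎
    where open ≡-Reasoning

  B*-after-N : ∀ i → i < b' → B* (N + suc i) ≡ B' (suc i)
  B*-after-N i i<b' = begin
    lookupOr ⊥ (⊥ ∷ blocks) (N + suc i)              ≡⟨ cong (lookupOr ⊥ (⊥ ∷ blocks)) (+-suc N i) ⟩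
    lookupOr ⊥ (spliced 0 b blocks') (N + i)         ≡⟨ cong (λ L → lookupOr ⊥ L (N + i)) (trans (cong (λ m → spliced 0 m blocks') (sym (+-identityʳ b))) (spliced-+ b 0 0 blocks')) ⟩
    lookupOr ⊥ (spliced 0 b [] ++ blocks') (N + i)   ≡⟨ lookupOr-++ʳ ⊥ (spliced 0 b []) blocks' i ⟩
    lookupOr ⊥ blocks' i                             ≡⟨ lookupOr-applyUpTo ⊥ (λ i → B' (suc i)) b' i i<b' ⟩
    B' (suc i)                                       ∎
    where open ≡-Reasoning

  U*-position' : ∀ j → j List.∈ idx' → j ≢ 0 → U* (N + j) ≡ U' j × N + j ≤ length blocks
  U*-position' zero _ 0≢0 = ⊥-elim (0≢0 refl)
  U*-position' (suc i) j∈ _ with suc i ≟ b'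
  ... | yes refl = trans (cong U* (sym length-blocks≡N+b'))
                     (unchanged-last B* (length blocks) Expansion.U0 Q (subst (1 ≤_) (sym length-blocks≡N+b') (≤-trans (s≤s z≤n) (m≤n+m b' N)))) ,
                   ≤-reflexive (sym length-blocks≡N+b')
  ... | no 1+i≢b' = (begin
    U* (N + suc i)                              ≡⟨ cong U* (+-suc N i) ⟩
    U* (suc (N + i))                            ≡⟨ U*-interior (N + i) 1+N+i<∣blocks∣ ⟩
    B* (suc (N + i)) ∩ B* (suc (suc (N + i)))   ≡⟨ cong₂ (λ p q → B* p ∩ B* q) (sym (+-suc N i)) (sym (trans (+-suc N (suc i)) (cong suc (+-suc N i)))) ⟩
    B* (N + suc i) ∩ B* (N + suc (suc i))       ≡⟨ cong₂ _∩_ (B*-after-N i (<⇒≤ 1+i<b')) (B*-after-N (suc i) 1+i<b') ⟩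
    B' (suc i) ∩ B' (suc (suc i))               ∎) ,
    subst (N + suc i ≤_) (sym length-blocks≡N+b') (+-monoʳ-≤ N (<⇒≤ 1+i<b'))
    where
    open ≡-Reasoning
    1+i<b' : suc i < b'
    1+i<b' = ≤∧≢⇒< (All.lookup Expansion'.idx≤b j∈) 1+i≢b'
    1+N+i<∣blocks∣ : suc (N + i) < length blocks
    1+N+i<∣blocks∣ = subst (suc (N + i) <_) (sym length-blocks≡N+b') (subst (_< N + b') (+-suc N i) (+-monoʳ-< N 1+i<b'))

  -- U'₀ = W is already the part U b of D, so D' contributes only its nonzero indices.
  idx'⁺ : List ℕ
  idx'⁺ = filter nonzero? idx'

  ∈-idx'⁺ : ∀ {j} → j List.∈ idx'⁺ → j List.∈ idx' × j ≢ 0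
  ∈-idx'⁺ = ∈-filter⁻ nonzero? {xs = idx'}

  part part' : ℕ → ℕ × Subset n
  part j = position j , U j
  part' j = N + j , U' j

  parts : List (ℕ × Subset n)
  parts = map part idx ++ map part' idx'⁺

  parts-unchanged : All (λ (i , P) → U* i ≡ P × i ≤ length blocks) parts
  parts-unchanged = All-++⁺ (All-map⁺ (All.tabulate (λ {j} → U*-position j)))
    (All-map⁺ (All.tabulate (λ {j} j∈ → U*-position' j (proj₁ (∈-idx'⁺ j∈)) (proj₂ (∈-idx'⁺ j∈)))))

  -- A common point of U i and U' j lies in X ∩ X' = U'₀, which is disjoint from U' j for j ≢ 0.
  parts-disjoint-across : ∀ i j → i List.∈ idx → j List.∈ idx'⁺ → U i ∩ U' j ≡ ⊥
  parts-disjoint-across i j i∈ j∈ = ⊆-antisym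
    (λ {x} h → ⊥-elim (Parts'.parts-disjoint j 0 j∈idx' (proj₁ ends') j≢0 (∩⁻ʳ h)
      (subst (x ∈_) (sym U'₀≡W) (∩⁺ (part⊆X i i∈ (∩⁻ˡ h)) (Parts'.part⊆X j j∈idx' (∩⁻ʳ h))))))
    (λ h → ⊥-elim (∉⊥ h))
    where
    j∈idx' : j List.∈ idx'
    j∈idx' = proj₁ (∈-idx'⁺ j∈)
    j≢0 : j ≢ 0
    j≢0 = proj₂ (∈-idx'⁺ j∈)

  parts-pairwise-disjoint : AllPairs (λ (_ , P) (_ , P′) → P ∩ P′ ≡ ⊥) parts
  parts-pairwise-disjoint = AllPairs.++⁺
    (AllPairs.map⁺ (AllPairs-from-∈ idx (Expansion.disjoint _ _) Expansion.idxUniq))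
    (AllPairs.map⁺ (AllPairs-from-∈ idx'⁺ (λ i∈ j∈ → Expansion'.disjoint _ _ (proj₁ (∈-idx'⁺ i∈)) (proj₁ (∈-idx'⁺ j∈)))
      (Unique.filter⁺ nonzero? Expansion'.idxUniq)))
    (All-map⁺ (All.tabulate (λ i∈ → All-map⁺ (All.tabulate (λ j∈ → parts-disjoint-across _ _ i∈ j∈)))))

  parts-nonempty : All (λ (_ , P) → Nonempty P) parts
  parts-nonempty = All-++⁺
    (All-map⁺ (All.tabulate (λ j∈ → ∣p∣≡1+m⇒Nonempty _ (∣part∣ _ j∈))))
    (All-map⁺ (All.tabulate (λ j∈ → ∣p∣≡1+m⇒Nonempty _ (Parts'.∣part∣ _ (proj₁ (∈-idx'⁺ j∈))))))

  X⊆⋃parts : X ⊆ ⋃ (map proj₂ parts)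
  X⊆⋃parts {x} x∈X with ⋃⁻ {ps = map U idx} (subst (x ∈_) (sym Expansion.cover) x∈X)
  ... | _ , P∈ , x∈P with ∈-map⁻ U P∈
  ... | j , j∈ , refl = ⋃⁺ (∈-map⁺ proj₂ (∈-++⁺ˡ (∈-map⁺ part j∈))) x∈P

  X'⊆⋃parts : X' ⊆ ⋃ (map proj₂ parts)
  X'⊆⋃parts {x} x∈X' with ⋃⁻ {ps = map U' idx'} (subst (x ∈_) (sym Expansion'.cover) x∈X')
  ... | _ , P∈ , x∈P with ∈-map⁻ U' P∈
  ... | zero , _ , refl = X⊆⋃parts (∩⁻ˡ (subst (x ∈_) U'₀≡W x∈P))
  ... | suc j , j∈ , refl = ⋃⁺ (∈-map⁺ proj₂ (∈-++⁺ʳ (map part idx) (∈-map⁺ part' (∈-filter⁺ nonzero? j∈ (λ ()))))) x∈P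

  ⋃parts⊆X∪X' : ⋃ (map proj₂ parts) ⊆ X ∪ X'
  ⋃parts⊆X∪X' h with ⋃⁻ {ps = map proj₂ parts} h
  ... | _ , P∈ , x∈P with ∈-map⁻ proj₂ P∈
  ... | _ , iP∈ , refl with ∈-++⁻ (map part idx) iP∈
  ...   | inj₁ iP∈ˡ with ∈-map⁻ part iP∈ˡ
  ...     | j , j∈ , refl = ∪⁺ˡ (part⊆X j j∈ x∈P)
  ⋃parts⊆X∪X' h | _ , P∈ , x∈P | _ , iP∈ , refl | inj₂ iP∈ʳ with ∈-map⁻ part' iP∈ʳ
  ...     | j , j∈ , refl = ∪⁺ʳ (Parts'.part⊆X j (proj₁ (∈-idx'⁺ j∈)) x∈P)

  parts-cover : ⋃ (map proj₂ parts) ≡ X ∪ X'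
  parts-cover = ⊆-antisym ⋃parts⊆X∪X' (λ h → [ X⊆⋃parts , X'⊆⋃parts ] (∪⁻ h))

  parts-count : (suc (suc c) ∸ 1) * length parts ≡ v + v' + 1 ∸ suc (suc c)
  parts-count = sym (begin
    v + v' + 1 ∸ suc a        ≡⟨ cong (_∸ suc a) (+-comm (v + v') 1) ⟩
    v + v' ∸ a                ≡⟨ cong (_∸ a) a*∣parts∣+a≡v+v' ⟨
    a * length parts + a ∸ a  ≡⟨ m+n∸n≡m _ a ⟩
    a * length parts          ∎)
    where
    open ≡-Reasoning
    open +-*-Solver
    a*∣parts∣+a≡v+v' : a * length parts + a ≡ v + v'
    a*∣parts∣+a≡v+v' = begin
      a * length parts + a
        ≡⟨ cong (λ m → a * m + a) (trans (length-++ (map part idx)) (cong₂ _+_ (length-map part idx) (length-map part' idx'⁺))) ⟩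
      a * (length idx + length idx'⁺) + a
        ≡⟨ solve 3 (λ a i i' → a :* (i :+ i') :+ a := a :* i :+ a :* (con 1 :+ i')) refl a (length idx) (length idx'⁺) ⟩
      a * length idx + a * suc (length idx'⁺)
        ≡⟨ cong₂ _+_ Expansion.idxCount
             (trans (cong (a *_) (1+length-filter-nonzero≡length idx' Expansion'.idxUniq (proj₁ ends'))) Expansion'.idxCount) ⟩
      v + v'                                  ∎

  blocks≡first-run : blocks ≡ extensions Expansion.U0 newPoints ++ B 1 ∷ spliced 1 bm blocks'
  blocks≡first-run = cong (_++ B 1 ∷ spliced 1 bm blocks') (insertions-∈ (proj₁ ends))

  t<∣blocks∣ : t < length blocks
  t<∣blocks∣ = subst (t <_) (sym (begin
    length blocks                                                   ≡⟨ cong length blocks≡first-run ⟩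
    length (extensions Expansion.U0 newPoints ++ B 1 ∷ spliced 1 bm blocks')
      ≡⟨ length-++ (extensions Expansion.U0 newPoints) ⟩
    length (extensions Expansion.U0 newPoints) + suc (length (spliced 1 bm blocks'))
      ≡⟨ cong (_+ suc (length (spliced 1 bm blocks'))) (length-map _ newPoints) ⟩
    t + suc (length (spliced 1 bm blocks'))                         ∎))
    (m<m+n t (s≤s z≤n))
    where open ≡-Reasoning

  a≤t : a ≤ t
  a≤t = subst (a ≤_) (sym t≡a+∣R∣) (m≤m+n a ∣ R ∣)

  someNewPoint : Fin n
  someNewPoint = proj₁ (∣p∣≡1+m⇒Nonempty Q Expansion'.∣Ub∣)

  newPoint : ℕ → Fin n
  newPoint i = lookupOr someNewPoint newPoints i

  first-run : ∀ i → i < t →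
    B* (suc i) ≡ Expansion.U0 ∪ ⁅ newPoint i ⁆ × Expansion.U0 ⊆ B* (suc (suc i)) × newPoint i ∉ B* (suc (suc i))
  first-run i i<t = subst
    (λ L → lookupOr ⊥ L i ≡ Expansion.U0 ∪ ⁅ newPoint i ⁆ × Expansion.U0 ⊆ lookupOr ⊥ L (suc i) × newPoint i ∉ lookupOr ⊥ L (suc i))
    (sym blocks≡first-run)
    (lookup-extensions Expansion.∣U0∣ Expansion.U0⊆B1 newPoints newPoints-Unique
      (λ y∈ → newPoint∉ y∈ (Design.block⊆X 1 ≤-refl (s≤s z≤n))) someNewPoint i i<t)

  U*-initial : ∀ i → i ≤ a → U* i ≡ Expansion.U0
  U*-initial zero _ = refl
  U*-initial (suc i) 1+i≤a with first-run i (≤-trans 1+i≤a a≤t)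
  ... | B*≡ , U0⊆next , y∉next = begin
    U* (suc i)                                                ≡⟨ U*-interior i (≤-trans (s≤s 1+i≤a) (≤-trans (s≤s a≤t) t<∣blocks∣)) ⟩
    B* (suc i) ∩ B* (suc (suc i))                             ≡⟨ cong (_∩ B* (suc (suc i))) B*≡ ⟩
    (Expansion.U0 ∪ ⁅ newPoint i ⁆) ∩ B* (suc (suc i))        ≡⟨ [p∪⁅y⁆]∩q≡p U0⊆next y∉next ⟩
    Expansion.U0                                              ∎
    where open ≡-Reasoning

  change : ℕ → Subset n
  change i = B* (suc i) ─ B* (suc (suc i))

  change≡ : ∀ i → i < a → change i ≡ ⁅ newPoint i ⁆
  change≡ i i<a with first-run i (≤-trans i<a a≤t)
  ... | B*≡ , U0⊆next , y∉next = trans (cong (_─ B* (suc (suc i))) B*≡) ([p∪⁅y⁆]─q≡⁅y⁆ U0⊆next y∉next)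

  ∣members-Q∣ : length (members Q) ≡ a
  ∣members-Q∣ = trans (length-members Q) Expansion'.∣Ub∣

  newPoint≡ : ∀ i → i < a → newPoint i ≡ lookupOr someNewPoint (members Q) i
  newPoint≡ i i<a = lookupOr-++ˡ someNewPoint (members Q) (members R) i (subst (i <_) (sym ∣members-Q∣) i<a)

  Q≡⋃changes : Q ≡ ⋃ (map change (upTo a))
  Q≡⋃changes = ⊆-antisym ⊆ʳ ⊇ʳ
    where
    ⊆ʳ : Q ⊆ ⋃ (map change (upTo a))
    ⊆ʳ {x} x∈Q with ∈⇒lookupOr {d = someNewPoint} (∈-members⁺ x∈Q)
    ... | i , i< , e = ⋃⁺ (∈-map⁺ change (∈-upTo⁺ i<a))
      (subst (x ∈_) (sym (change≡ i i<a)) (x≡y⇒x∈⁅y⁆ (sym (trans (newPoint≡ i i<a) e))))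
      where
      i<a : i < a
      i<a = subst (i <_) ∣members-Q∣ i<
    ⊇ʳ : ⋃ (map change (upTo a)) ⊆ Q
    ⊇ʳ {x} h with ⋃⁻ {ps = map change (upTo a)} h
    ... | _ , P∈ , x∈P with ∈-map⁻ change P∈
    ... | i , i∈ , refl = subst (_∈ Q) (sym (trans (x∈⁅y⁆⇒x≡y _ (subst (x ∈_) (change≡ i i<a) x∈P)) (newPoint≡ i i<a)))
      (∈-members⁻ {p = Q} (lookupOr-∈ someNewPoint (members Q) i (subst (i <_) (sym ∣members-Q∣) i<a)))
      where
      i<a : i < a
      i<a = ∈-upTo⁻ i∈

  E* : ExpansionSet D*
  E* = ExpansionSetFromParts.expansionSet D* (≤-trans (s≤s z≤n) t<∣blocks∣) Expansion.U0 Q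
    (λ h → subst (_ ∈_) (sym (proj₁ (first-run 0 0<t))) (∪⁺ˡ h)) Expansion.∣U0∣
    (λ h → subst (_ ∈_) (sym (trans (cong B* length-blocks≡N+b') (B*-after-N bm' ≤-refl))) (Expansion'.Ub⊆Bb h)) Expansion'.∣Ub∣
    parts parts-unchanged parts-pairwise-disjoint parts-nonempty parts-cover parts-count

  disjointCapable : DisjointCapable E*
  disjointCapable =
    (∈-map⁺ proj₁ (∈-++⁺ˡ (∈-map⁺ part (proj₁ ends))) ,
     subst (List._∈ map proj₁ parts) (sym length-blocks≡N+b')
       (∈-map⁺ proj₁ (∈-++⁺ʳ (map part idx) (∈-map⁺ part' (∈-filter⁺ nonzero? (proj₂ ends') (λ ())))))) ,
    U*-initial , Q≡⋃changes

  outer : Outer E*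
  outer = inj₁ (proj₁ (proj₁ disjointCapable))


alignLast : {X W : Subset n} {v k b : ℕ} → W ⊆ X → ∣ W ∣ ≡ k ∸ 1 →
  ExpandedSCCD X v k b → Σ (ExpandedSCCD X v k b) λ P → ExpansionSet.Ub (ExpandedSCCD.expansion P) ≡ W
alignLast {b = b} W⊆X ∣W∣ = Alignment.alignEnd _ W⊆X ∣W∣ (λ P → ExpansionSet.Ub (ExpandedSCCD.expansion P)) (λ _ _ → refl)
  (λ (expanded D E _) h → SCCD.block⊆X D b (ExpansionSet.b≥1 E) ≤-refl (ExpansionSet.Ub⊆Bb E h))
  (λ P → ExpansionSet.∣Ub∣ (ExpandedSCCD.expansion P))

alignFirst : {X W : Subset n} {v k b : ℕ} → W ⊆ X → ∣ W ∣ ≡ k ∸ 1 →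
  ExpandedSCCD X v k b → Σ (ExpandedSCCD X v k b) λ P → ExpansionSet.U0 (ExpandedSCCD.expansion P) ≡ W
alignFirst W⊆X ∣W∣ = Alignment.alignEnd _ W⊆X ∣W∣ (λ P → ExpansionSet.U0 (ExpandedSCCD.expansion P)) (λ _ _ → refl)
  (λ (expanded D E _) h → SCCD.block⊆X D 1 ≤-refl (ExpansionSet.b≥1 E) (ExpansionSet.U0⊆B1 E h))
  (λ P → ExpansionSet.∣U0∣ (ExpandedSCCD.expansion P))

theorem5 : ∀ {n : ℕ} (X X' : Subset n) (v v' k b b' : ℕ) → 2 ≤ k →
    (D : SCCD X v k b) (D' : SCCD X' v' k b') →
    (E : ExpansionSet D) → ContainsBothEnds E →
    (E' : ExpansionSet D') → ContainsBothEnds E' →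
    ∣ X ∩ X' ∣ ≡ k ∸ 1 →
    Σ (SCCD (X ∪ X') (v + v' + 1 ∸ k) k
            (b + b' + ((v' + 1 ∸ k) * (v + 1 ∸ k)) div (k ∸ 1))) λ D* →
    Σ (ExpansionSet D*) λ E* →
      DisjointCapable E* × Outer E* ×
      excess (v + v' + 1 ∸ k) k (b + b' + ((v' + 1 ∸ k) * (v + 1 ∸ k)) div (k ∸ 1))
        ≡ excess v k b +ℤ excess v' k b'
theorem5 X X' v v' (suc (suc c)) (suc bm) (suc bm') _ D D' E ends E' ends' ∣W∣
  with alignLast ∩⁻ˡ ∣W∣ (expanded D E ends) | alignFirst ∩⁻ʳ ∣W∣ (expanded D' E' ends')
... | expanded D₁ E₁ ends₁ , U_b≡W | expanded D₂ E₂ ends₂ , U'₀≡W =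
  let D*′ , E*′ , capable , isOuter = subst Concatenated length≡b* (D* , E* , disjointCapable , outer)
  in D*′ , E*′ , capable , isOuter , excess-additive c l t (suc bm) (suc bm') v v' v≡a*[1+l] (sym t+a≡v')
  where
  open Concatenation c bm bm' D₁ E₁ ends₁ D₂ E₂ ends₂ ∣W∣ U_b≡W U'₀≡W
  Concatenated : ℕ → Set
  Concatenated b* = Σ (SCCD (X ∪ X') (v + v' + 1 ∸ suc (suc c)) (suc (suc c)) b*) λ D* →
    Σ (ExpansionSet D*) λ E* → DisjointCapable E* × Outer E*
  length≡b* : length blocks ≡ suc bm + suc bm' + ((v' + 1 ∸ suc (suc c)) * (v + 1 ∸ suc (suc c))) div (suc (suc c) ∸ 1)
  length≡b* = trans length-blocks (cong (suc bm + suc bm' +_) (sym (inserted-count c l t v v' v≡a*[1+l] (sym t+a≡v'))))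
theorem5 _ _ _ _ zero _ _ () _ _ _ _ _ _ _
theorem5 _ _ _ _ (suc zero) _ _ (s≤s ()) _ _ _ _ _ _ _
theorem5 _ _ _ _ (suc (suc c)) zero _ _ _ _ E _ _ _ _ with () ← ExpansionSet.b≥1 E
theorem5 _ _ _ _ (suc (suc c)) (suc bm) zero _ _ _ _ _ E' _ _ with () ← ExpansionSet.b≥1 E'
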